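{- Let $d\ge2$ be an integer, $A,B\in\mathbb{Q}[z]$ with $B\ne0$, $r_a=\deg A$, $r_b=\deg B$, and let $f\in\mathbb{Q}((z^{ -1}))$, not a rational function, satisfy $f(z)=\frac{A(z)}{B(z)}f(z^d)$. Let $[u,v]$ be a big gap in $\Phi$ with gap's convergent $p_u/q_u$. Then the fraction $$\frac{A(z)p_u(z^d)}{B(z)q_u(z^d)}$$ is a convergent of $f$. Moreover, the gap in $\Phi$ which corresponds to this convergent (i.e. whose left endpoint is the degree of the denominator of this fraction in lowest terms) has size bigger than $v-u$.
   Context: Convergents: writing $f=[a_0(z),a_1(z),\ldots]$ as a continued fraction with polynomial partial quotients, the $k$-th convergent is $p_k/q_k=[a_0,\ldots,a_k]$ with $p_k,q_k$ coprime. $\Phi=\{\deg q_k:k\in\mathbb{N}\}$. A gap in $\Phi$ is a pair $[u,v]$ with $u<v$ both in $\Phi$ and no element of $\Phi$ strictly between; its size is $v-u$; its gap's convergent is the convergent $p_u/q_u$ with $\deg q_u=u$. A gap is big if its size exceeds $\frac{r_a+r_b}{d-1}$. -}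

module Defs where

open import Data.Nat as ℕ using (ℕ; zero; suc; _∸_)
open import Data.Nat.DivMod using (_/_)
open import Data.Nat.Divisibility using (_∣?_)
open import Data.Integer as ℤ using (ℤ; +_; ∣_∣)
open import Data.Rational as ℚ using (ℚ; 0ℚ; 1ℚ)
open import Data.Product using (Σ; _×_; _,_; proj₁; proj₂; ∃)
open import Relation.Nullary using (¬_; yes; no)
open import Relation.Binary.PropositionalEquality using (_≡_; _≢_)

-- Formal Laurent series in z⁻¹ over ℚ  (elements of ℚ((z⁻¹))).
-- A series  mk T c  represents  Σ_{k ≥ 0} c k · z^(T - k).

record Series : Set where
  constructor mk
  field
    top   : ℤ
    coeff : ℕ → ℚ
open Series public

coeffAt : Series → ℤ → ℚ
coeffAt (mk T c) n with n ℤ.≤? T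
... | yes _ = c ∣ T ℤ.- n ∣
... | no  _ = 0ℚ

fromFn : ℤ → (ℤ → ℚ) → Series
fromFn T g = mk T (λ k → g (T ℤ.- + k))

infix 4 _≈_
_≈_ : Series → Series → Set
f ≈ g = ∀ n → coeffAt f n ≡ coeffAt g n

zeroS oneS : Series
zeroS = fromFn (+ 0) (λ _ → 0ℚ)
oneS  = mk (+ 0) (λ { zero → 1ℚ ; (suc _) → 0ℚ })

infixl 6 _+S_
infixl 7 _*S_

_+S_ : Series → Series → Series
f +S g = fromFn (top f ℤ.⊔ top g) (λ n → coeffAt f n ℚ.+ coeffAt g n)

sumTo : ℕ → (ℕ → ℚ) → ℚ
sumTo zero    h = h 0
sumTo (suc k) h = sumTo k h ℚ.+ h (suc k)

_*S_ : Series → Series → Series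
mk T c *S mk U e = mk (T ℤ.+ U) (λ k → sumTo k (λ i → c i ℚ.* e (k ∸ i)))

quot : ℕ → ℕ → ℕ
quot k zero    = 0
quot k (suc e) = k / suc e

compose : Series → ℕ → Series
compose (mk T c) d = mk (+ d ℤ.* T) (λ k → h k (d ∣? k))
  where
  h : ∀ k → _ → ℚ
  h k (yes _) = c (quot k d)
  h k (no _)  = 0ℚ

polyPart : Series → Series
polyPart f = fromFn (top f) (λ n → h n (+ 0 ℤ.≤? n))
  where
  h : ∀ n → _ → ℚ
  h n (yes _) = coeffAt f n
  h n (no _)  = 0ℚ

fracPart : Series → Series
fracPart f = fromFn (ℤ.- (+ 1)) (coeffAt f)

IsPoly : Series → Set
IsPoly f = ∀ n → n ℤ.< + 0 → coeffAt f n ≡ 0ℚ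

HasDeg : Series → ℤ → Set
HasDeg f n = (coeffAt f n ≢ 0ℚ) × (∀ m → n ℤ.< m → coeffAt f m ≡ 0ℚ)

IsRational : Series → Set
IsRational f = Σ Series λ P → Σ Series λ Q →
  IsPoly P × IsPoly Q × ¬ (Q ≈ zeroS) × (Q *S f ≈ P)

-- Continued fraction expansion f = [a₀, a₁, …]:
-- complete quotients t k with t 0 = f, t (k+1) = 1 / fracPart (t k),
-- partial quotients a k = polyPart (t k).

record CFExpansion (f : Series) : Set where
  field
    tail     : ℕ → Series
    tail0    : tail 0 ≈ f
    tailStep : ∀ k → tail (suc k) *S fracPart (tail k) ≈ oneS

  a : ℕ → Series
  a k = polyPart (tail k)

  -- (p_{k-1}, p_k) and (q_{k-1}, q_k) by the standard recurrences
  -- p_{-1} = 1, p_0 = a_0, q_{-1} = 0, q_0 = 1,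
  -- p_k = a_k p_{k-1} + p_{k-2}, q_k = a_k q_{k-1} + q_{k-2}.
  PP : ℕ → Series × Series
  PP zero    = oneS , a 0
  PP (suc k) = proj₂ (PP k) , a (suc k) *S proj₂ (PP k) +S proj₁ (PP k)

  QQ : ℕ → Series × Series
  QQ zero    = zeroS , oneS
  QQ (suc k) = proj₂ (QQ k) , a (suc k) *S proj₂ (QQ k) +S proj₁ (QQ k)

  p q : ℕ → Series
  p k = proj₂ (PP k)
  q k = proj₂ (QQ k)

  InΦ : ℕ → Set
  InΦ m = ∃ λ k → HasDeg (q k) (+ m)

  Gap : ℕ → ℕ → Set
  Gap u v = u ℕ.< v × InΦ u × InΦ v × (∀ w → u ℕ.< w → w ℕ.< v → ¬ InΦ w)

{-# OPTIONS --safe #-}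
-- Write Q = B·q_u(zᵈ) and P = A·p_u(zᵈ). The functional equation turns Q f − P into A·(q_u f − p_u)(zᵈ),
-- which has degree at most r_a − d·v since the next convergent denominator has degree ≥ v. Let q_j be the
-- convergent denominator with deg q_j ≤ deg Q < deg q_{j+1}. Then Q p_j − P q_j = q_j (Q f − P) − Q (q_j f − p_j)
-- is a polynomial, and bigness of the gap makes both terms of negative degree, so P/Q = p_j/q_j. Comparing
-- degrees in Q (q_j f − p_j) = q_j (Q f − P) then forces deg q_{j+1} − deg q_j > v − u.

module Submission where

open import Defs
open import Data.Nat using (ℕ; zero; suc; _∸_; z≤n; s≤s; _+_; _*_; _≤_; _<_)
import Data.Nat.Properties as NP
open import Data.Nat.Divisibility using (_∣_; divides; _∣?_; ∣m+n∣m⇒∣n; ∣m∸n∣n⇒∣m; n∣m*n; ∣⇒≤)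
open import Data.Nat.DivMod using (m*n/n≡m)
open import Data.Integer using (ℤ; +_; -[1+_]; ∣_∣; _⊔_) renaming (suc to sucℤ; _+_ to _+ᶻ_; _-_ to _-ᶻ_; _*_ to _*ᶻ_; -_ to negᶻ; _≤_ to _≤ᶻ_; _<_ to _<ᶻ_; _≤?_ to _≤ᶻ?_)
open import Data.Integer.Base using (+≤+; +<+; -≤+; -<+)
import Data.Integer.Properties as ZP
open import Data.Integer.Tactic.RingSolver using (solve-∀)
open import Data.Nat.Tactic.RingSolver using () renaming (solve-∀ to ℕsolve-∀)
open import Data.Rational using (ℚ; 0ℚ; 1ℚ) renaming (_+_ to _+ᵠ_; _*_ to _*ᵠ_; -_ to -ᵠ_)
import Data.Rational.Base as QB
import Data.Rational.Properties as QP
open import Data.Product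
open import Data.Sum using (_⊎_; inj₁; inj₂)
open import Data.Empty
open import Data.Maybe using (Maybe; just; nothing)
open import Relation.Nullary
open import Relation.Binary.PropositionalEquality
open import Relation.Binary.Structures using (IsEquivalence)
import Relation.Binary.Reasoning.Setoid as SetR
open import Algebra.Structures using (IsCommutativeRing)
open import Algebra.Bundles using (CommutativeRing; CommutativeMonoid)
open import Algebra.Properties.CommutativeSemigroup (CommutativeMonoid.commutativeSemigroup QP.+-0-commutativeMonoid) using () renaming (interchange to +-interchange)
import Algebra.Solver.Ring.AlmostCommutativeRing as ASR
import Algebra.Solver.Ring as RSolver
open import Function using (_∘_)

≤⇒offset : ∀ {i j} → i ≤ᶻ j → Σ ℕ λ k → j ≡ i +ᶻ + k
≤⇒offset {i} {j} p = ∣ j -ᶻ i ∣ , (begin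
    j ≡⟨ ring j i ⟩
    i +ᶻ (j -ᶻ i) ≡⟨ cong (i +ᶻ_) (sym (ZP.0≤i⇒+∣i∣≡i (ZP.i≤j⇒0≤j-i p))) ⟩
    i +ᶻ + ∣ j -ᶻ i ∣ ∎)
  where
  open ≡-Reasoning
  ring : ∀ j i → j ≡ i +ᶻ (j -ᶻ i)
  ring = solve-∀

offset⇒≤ : ∀ {i j} k → j ≡ i +ᶻ + k → i ≤ᶻ j
offset⇒≤ {i} k refl = ZP.i≤i+j i (+ k)

sucℤ[i]+k≡i+suc[k] : ∀ i k → sucℤ i +ᶻ + k ≡ i +ᶻ + suc k
sucℤ[i]+k≡i+suc[k] i k = trans (cong (_+ᶻ + k) (ZP.+-comm (+ 1) i)) (ZP.+-assoc i (+ 1) (+ k))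

<⇒offset : ∀ {i j} → i <ᶻ j → Σ ℕ λ k → j ≡ i +ᶻ + suc k
<⇒offset {i} {j} p with ≤⇒offset (ZP.i<j⇒suc[i]≤j p)
... | k , eq = k , trans eq (sucℤ[i]+k≡i+suc[k] i k)

offset⇒< : ∀ {i j} k → j ≡ i +ᶻ + suc k → i <ᶻ j
offset⇒< {i} {j} k eq = ZP.suc[i]≤j⇒i<j (offset⇒≤ k (trans eq (sym (sucℤ[i]+k≡i+suc[k] i k))))

j≡i+k⇒i≡j-k : ∀ {i j k} → j ≡ i +ᶻ k → i ≡ j -ᶻ k
j≡i+k⇒i≡j-k {i} {k = k} refl = cancel i k
  where
  cancel : ∀ i k → i ≡ i +ᶻ k -ᶻ k
  cancel = solve-∀

i<i+1 : ∀ i → i <ᶻ i +ᶻ + 1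
i<i+1 i = offset⇒< 0 refl

sumTo-cong : ∀ K {h g : ℕ → ℚ} → (∀ i → i ≤ K → h i ≡ g i) → sumTo K h ≡ sumTo K g
sumTo-cong zero e = e 0 z≤n
sumTo-cong (suc K) e = cong₂ _+ᵠ_ (sumTo-cong K (λ i p → e i (NP.m≤n⇒m≤1+n p))) (e (suc K) NP.≤-refl)

sumTo-0 : ∀ K {h : ℕ → ℚ} → (∀ i → i ≤ K → h i ≡ 0ℚ) → sumTo K h ≡ 0ℚ
sumTo-0 zero e = e 0 z≤n
sumTo-0 (suc K) e = trans (cong₂ _+ᵠ_ (sumTo-0 K (λ i p → e i (NP.m≤n⇒m≤1+n p))) (e (suc K) NP.≤-refl)) refl

sumTo-+ : ∀ K (h g : ℕ → ℚ) → sumTo K (λ i → h i +ᵠ g i) ≡ sumTo K h +ᵠ sumTo K g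
sumTo-+ zero h g = refl
sumTo-+ (suc K) h g =
  trans (cong (_+ᵠ (h (suc K) +ᵠ g (suc K))) (sumTo-+ K h g)) (+-interchange (sumTo K h) (sumTo K g) (h (suc K)) (g (suc K)))

sumTo-*ˡ : ∀ K x (h : ℕ → ℚ) → sumTo K (λ i → x *ᵠ h i) ≡ x *ᵠ sumTo K h
sumTo-*ˡ zero x h = refl
sumTo-*ˡ (suc K) x h = trans (cong (_+ᵠ (x *ᵠ h (suc K))) (sumTo-*ˡ K x h)) (sym (QP.*-distribˡ-+ x (sumTo K h) (h (suc K))))

sumTo-*ʳ : ∀ K x (h : ℕ → ℚ) → sumTo K (λ i → h i *ᵠ x) ≡ sumTo K h *ᵠ x
sumTo-*ʳ zero x h = refl
sumTo-*ʳ (suc K) x h = trans (cong (_+ᵠ (h (suc K) *ᵠ x)) (sumTo-*ʳ K x h)) (sym (QP.*-distribʳ-+ x (sumTo K h) (h (suc K))))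

sumTo-shift : ∀ K (h : ℕ → ℚ) → sumTo (suc K) h ≡ h 0 +ᵠ sumTo K (h ∘ suc)
sumTo-shift zero h = refl
sumTo-shift (suc K) h = trans (cong (_+ᵠ h (suc (suc K))) (sumTo-shift K h)) (QP.+-assoc (h 0) (sumTo K (h ∘ suc)) (h (suc (suc K))))

sumTo-extend : ∀ K j (h : ℕ → ℚ) → (∀ i → K < i → h i ≡ 0ℚ) → sumTo (K + j) h ≡ sumTo K h
sumTo-extend K zero h z rewrite NP.+-identityʳ K = refl
sumTo-extend K (suc j) h z rewrite NP.+-suc K j =
  trans (cong₂ _+ᵠ_ (sumTo-extend K j h z) (z (suc (K + j)) (s≤s (NP.m≤m+n K j)))) (QP.+-identityʳ _)

sumTo-rev : ∀ K (h : ℕ → ℚ) → sumTo K h ≡ sumTo K (λ i → h (K ∸ i))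
sumTo-rev zero h = refl
sumTo-rev (suc K) h = begin
    sumTo K h +ᵠ h (suc K)
      ≡⟨ cong (_+ᵠ h (suc K)) (sumTo-rev K h) ⟩
    sumTo K (λ i → h (K ∸ i)) +ᵠ h (suc K)
      ≡⟨ QP.+-comm (sumTo K (λ i → h (K ∸ i))) (h (suc K)) ⟩
    h (suc K) +ᵠ sumTo K (λ i → h (K ∸ i))
      ≡⟨ cong (h (suc K) +ᵠ_) refl ⟩
    h (suc K) +ᵠ sumTo K (λ i → h (suc K ∸ suc i))
      ≡⟨ sym (sumTo-shift K (λ i → h (suc K ∸ i))) ⟩
    sumTo (suc K) (λ i → h (suc K ∸ i)) ∎
  where open ≡-Reasoning

sumTo-triangle : ∀ K (h : ℕ → ℕ → ℚ) →
  sumTo K (λ i → sumTo i (λ j → h j (i ∸ j))) ≡ sumTo K (λ j → sumTo (K ∸ j) (λ l → h j l))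
sumTo-triangle zero h = refl
sumTo-triangle (suc K) h = begin
    sumTo (suc K) F
      ≡⟨ sumTo-shift K F ⟩
    h 0 0 +ᵠ sumTo K (F ∘ suc)
      ≡⟨ cong (h 0 0 +ᵠ_) (sumTo-cong K (λ i _ → sumTo-shift i (λ j → h j (suc i ∸ j)))) ⟩
    h 0 0 +ᵠ sumTo K (λ i → h 0 (suc i) +ᵠ sumTo i (λ j → h (suc j) (i ∸ j)))
      ≡⟨ cong (h 0 0 +ᵠ_) (sumTo-+ K (λ i → h 0 (suc i)) _) ⟩
    h 0 0 +ᵠ (sumTo K (λ i → h 0 (suc i)) +ᵠ sumTo K (λ i → sumTo i (λ j → h (suc j) (i ∸ j))))
      ≡⟨ cong (λ z → h 0 0 +ᵠ (sumTo K (λ i → h 0 (suc i)) +ᵠ z)) (sumTo-triangle K (h ∘ suc)) ⟩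
    h 0 0 +ᵠ (sumTo K (λ i → h 0 (suc i)) +ᵠ sumTo K (λ j → sumTo (K ∸ j) (λ l → h (suc j) l)))
      ≡⟨ sym (QP.+-assoc (h 0 0) _ _) ⟩
    (h 0 0 +ᵠ sumTo K (λ i → h 0 (suc i))) +ᵠ sumTo K (λ j → sumTo (K ∸ j) (λ l → h (suc j) l))
      ≡⟨ cong (_+ᵠ sumTo K (λ j → sumTo (K ∸ j) (λ l → h (suc j) l))) (sym (sumTo-shift K (h 0))) ⟩
    sumTo (suc K) (h 0) +ᵠ sumTo K (λ j → sumTo (K ∸ j) (λ l → h (suc j) l))
      ≡⟨ sym (sumTo-shift K (λ j → sumTo (suc K ∸ j) (λ l → h j l))) ⟩
    sumTo (suc K) (λ j → sumTo (suc K ∸ j) (λ l → h j l)) ∎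
  where
  open ≡-Reasoning
  F : ℕ → ℚ
  F i = sumTo i (λ j → h j (i ∸ j))

sumTo-first : ∀ K (h : ℕ → ℚ) → (∀ i → 1 ≤ i → i ≤ K → h i ≡ 0ℚ) → sumTo K h ≡ h 0
sumTo-first zero h z = refl
sumTo-first (suc K) h z = trans (sumTo-shift K h)
  (trans (cong (h 0 +ᵠ_) (sumTo-0 K (λ i p → z (suc i) (s≤s z≤n) (s≤s p)))) (QP.+-identityʳ (h 0)))

sumTo≢0⇒term≢0 : ∀ K (h : ℕ → ℚ) → ¬ (sumTo K h ≡ 0ℚ) → Σ ℕ λ i → i ≤ K × ¬ (h i ≡ 0ℚ)
sumTo≢0⇒term≢0 K h nz with all-zero-or-witness K
  where
  all-zero-or-witness : ∀ K → (Σ ℕ λ i → i ≤ K × ¬ (h i ≡ 0ℚ)) ⊎ (∀ i → i ≤ K → h i ≡ 0ℚ)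
  all-zero-or-witness zero with h 0 QP.≟ 0ℚ
  ... | yes p = inj₂ (λ { zero _ → p })
  ... | no p = inj₁ (0 , z≤n , p)
  all-zero-or-witness (suc K) with h (suc K) QP.≟ 0ℚ | all-zero-or-witness K
  ... | no p | _ = inj₁ (suc K , NP.≤-refl , p)
  ... | yes _ | inj₁ (i , q , r) = inj₁ (i , NP.m≤n⇒m≤1+n q , r)
  ... | yes p | inj₂ a = inj₂ λ i q → zero-upto-suc i q
    where
    zero-upto-suc : ∀ i → i ≤ suc K → h i ≡ 0ℚ
    zero-upto-suc i q with NP.m≤n⇒m<n∨m≡n q
    ... | inj₁ (s≤s r) = a i r
    ... | inj₂ refl = p
... | inj₁ x = x
... | inj₂ a = ⊥-elim (nz (sumTo-0 K a))

sumTo-split : ∀ a b (h : ℕ → ℚ) → sumTo (a + suc b) h ≡ sumTo a h +ᵠ sumTo b (λ j → h (a + suc j))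
sumTo-split a zero h = trans (cong (λ z → sumTo z h) (NP.+-comm a 1)) (cong (λ z → sumTo a h +ᵠ h z) (NP.+-comm 1 a))
sumTo-split a (suc b) h =
  trans (cong (λ z → sumTo z h) (NP.+-suc a (suc b)))
  (trans (cong (_+ᵠ h (suc (a + suc b))) (sumTo-split a b h))
    (trans (QP.+-assoc (sumTo a h) (sumTo b (λ j → h (a + suc j))) (h (suc (a + suc b))))
      (cong (λ z → sumTo a h +ᵠ (sumTo b (λ j → h (a + suc j)) +ᵠ h z)) (sym (NP.+-suc a (suc b))))))

sumTo-last : ∀ K (g : ℕ → ℚ) → (∀ j → j < K → g j ≡ 0ℚ) → sumTo K g ≡ g K
sumTo-last zero g z = refl
sumTo-last (suc K) g z = trans (cong (_+ᵠ g (suc K)) (sumTo-0 K (λ j p → z j (s≤s p)))) (QP.+-identityˡ (g (suc K)))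

sumTo-multiples : ∀ e k (h : ℕ → ℚ) → (∀ i → ¬ (suc e ∣ i) → h i ≡ 0ℚ) → sumTo (k * suc e) h ≡ sumTo k (λ j → h (j * suc e))
sumTo-multiples e zero h z = refl
sumTo-multiples e (suc k) h z = begin
    sumTo (suc e + k * suc e) h ≡⟨ cong (λ x → sumTo x h) (NP.+-comm (suc e) (k * suc e)) ⟩
    sumTo (k * suc e + suc e) h ≡⟨ sumTo-split (k * suc e) e h ⟩
    sumTo (k * suc e) h +ᵠ sumTo e (λ j → h (k * suc e + suc j))
      ≡⟨ cong₂ _+ᵠ_ (sumTo-multiples e k h z) (sumTo-last e _ (λ j p → z _ (nd j p))) ⟩
    sumTo k (λ j → h (j * suc e)) +ᵠ h (k * suc e + suc e)
      ≡⟨ cong (λ x → sumTo k (λ j → h (j * suc e)) +ᵠ h x) (NP.+-comm (k * suc e) (suc e)) ⟩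
    sumTo (suc k) (λ j → h (j * suc e)) ∎
  where
  open ≡-Reasoning
  nd : ∀ j → j < e → ¬ (suc e ∣ k * suc e + suc j)
  nd j p dv = NP.<⇒≱ (s≤s p) (∣⇒≤ (∣m+n∣m⇒∣n dv (n∣m*n k)))

+[m∸n]≡+m-+n : ∀ {i k} → i ≤ k → + (k ∸ i) ≡ + k -ᶻ + i
+[m∸n]≡+m-+n {i} {k} i≤k = sym (trans (ZP.m-n≡m⊖n k i) (ZP.⊖-≥ i≤k))

+∣T-n∣≡T-n : ∀ {n T} → n ≤ᶻ T → + ∣ T -ᶻ n ∣ ≡ T -ᶻ n
+∣T-n∣≡T-n p = ZP.0≤i⇒+∣i∣≡i (ZP.i≤j⇒0≤j-i p)

T-+∣T-n∣≡n : ∀ {n T} → n ≤ᶻ T → T -ᶻ + ∣ T -ᶻ n ∣ ≡ n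
T-+∣T-n∣≡n {n} {T} p = trans (cong (T -ᶻ_) (+∣T-n∣≡T-n p)) (ring T n)
  where
  ring : ∀ T n → T -ᶻ (T -ᶻ n) ≡ n
  ring = solve-∀

∣T-[T-k]∣≡k : ∀ T k → ∣ T -ᶻ (T -ᶻ + k) ∣ ≡ k
∣T-[T-k]∣≡k T k = cong ∣_∣ (ring T (+ k))
  where
  ring : ∀ T x → T -ᶻ (T -ᶻ x) ≡ x
  ring = solve-∀

≤⊎> : ∀ n T → n ≤ᶻ T ⊎ T <ᶻ n
≤⊎> n T with n ≤ᶻ? T
... | yes p = inj₁ p
... | no np = inj₂ (ZP.≰⇒> np)

VanishesAbove : (ℤ → ℚ) → ℤ → Set
VanishesAbove F T = ∀ n → T <ᶻ n → F n ≡ 0ℚ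

coeffAt-top∸ : ∀ T c k → coeffAt (mk T c) (T -ᶻ + k) ≡ c k
coeffAt-top∸ T c k with (T -ᶻ + k) ≤ᶻ? T
... | yes _ = cong c (∣T-[T-k]∣≡k T k)
... | no np = ⊥-elim (np (ZP.i-j≤i T (+ k)))

coeffAt-≤top : ∀ T c n → n ≤ᶻ T → coeffAt (mk T c) n ≡ c ∣ T -ᶻ n ∣
coeffAt-≤top T c n p with n ≤ᶻ? T
... | yes _ = refl
... | no np = ⊥-elim (np p)

vanishesAbove-top : ∀ f → VanishesAbove (coeffAt f) (top f)
vanishesAbove-top (mk T c) n p with n ≤ᶻ? T
... | yes q = ⊥-elim (ZP.<⇒≱ p q)
... | no _ = refl

coeffAt-fromFn : ∀ T g n → n ≤ᶻ T → coeffAt (fromFn T g) n ≡ g n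
coeffAt-fromFn T g n p = trans (coeffAt-≤top T _ n p) (cong g (T-+∣T-n∣≡n p))

coeffAt-fromFn-vanishing : ∀ T g → VanishesAbove g T → ∀ n → coeffAt (fromFn T g) n ≡ g n
coeffAt-fromFn-vanishing T g v n with ≤⊎> n T
... | inj₁ p = coeffAt-fromFn T g n p
... | inj₂ q = trans (vanishesAbove-top (fromFn T g) n q) (sym (v n q))

VanishesAbove-mono : ∀ {F T U} → T ≤ᶻ U → VanishesAbove F T → VanishesAbove F U
VanishesAbove-mono p v n q = v n (ZP.≤-<-trans p q)

≡0⇒*-zeroˡ : ∀ {a} x → a ≡ 0ℚ → a *ᵠ x ≡ 0ℚ
≡0⇒*-zeroˡ x refl = QP.*-zeroˡ x

≡0⇒*-zeroʳ : ∀ {a} x → a ≡ 0ℚ → x *ᵠ a ≡ 0ℚ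
≡0⇒*-zeroʳ x refl = QP.*-zeroʳ x

-- The coefficient of zⁿ in a product, summed over a window: F vanishes above T and G above n − T + K.
conv : (ℤ → ℚ) → (ℤ → ℚ) → ℤ → ℤ → ℕ → ℚ
conv F G T n K = sumTo K (λ i → F (T -ᶻ + i) *ᵠ G (n -ᶻ T +ᶻ + i))

coeffAt-*S-canonical : ∀ T c U e n → n ≤ᶻ T +ᶻ U →
  coeffAt (mk T c *S mk U e) n ≡ conv (coeffAt (mk T c)) (coeffAt (mk U e)) T n ∣ (T +ᶻ U) -ᶻ n ∣
coeffAt-*S-canonical T c U e n p = trans (coeffAt-≤top (T +ᶻ U) _ n p)
  (sumTo-cong k0 (λ i q → sym (cong₂ _*ᵠ_ (coeffAt-top∸ T c i) (trans (cong (coeffAt (mk U e)) (idx i q)) (coeffAt-top∸ U e (k0 ∸ i))))))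
  where
  k0 = ∣ (T +ᶻ U) -ᶻ n ∣
  idx : ∀ i → i ≤ k0 → n -ᶻ T +ᶻ + i ≡ U -ᶻ + (k0 ∸ i)
  idx i q = begin
      n -ᶻ T +ᶻ + i ≡⟨ ring′ n T U (+ i) ⟩
      U -ᶻ (((T +ᶻ U) -ᶻ n) -ᶻ + i) ≡⟨ cong (λ z → U -ᶻ (z -ᶻ + i)) (sym (+∣T-n∣≡T-n p)) ⟩
      U -ᶻ (+ k0 -ᶻ + i) ≡⟨ cong (U -ᶻ_) (sym (+[m∸n]≡+m-+n q)) ⟩
      U -ᶻ + (k0 ∸ i) ∎
    where
    open ≡-Reasoning
    ring′ : ∀ n T U i → n -ᶻ T +ᶻ i ≡ U -ᶻ (((T +ᶻ U) -ᶻ n) -ᶻ i)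
    ring′ = solve-∀

conv-raise-suc : ∀ F G T n K → VanishesAbove F T → conv F G T n K ≡ conv F G (T +ᶻ + 1) n (suc K)
conv-raise-suc F G T n K v = sym (begin
    conv F G (T +ᶻ + 1) n (suc K)
      ≡⟨ sumTo-shift K _ ⟩
    F ((T +ᶻ + 1) -ᶻ + 0) *ᵠ G (n -ᶻ (T +ᶻ + 1) +ᶻ + 0) +ᵠ sumTo K (λ i → F ((T +ᶻ + 1) -ᶻ + suc i) *ᵠ G (n -ᶻ (T +ᶻ + 1) +ᶻ + suc i))
      ≡⟨ cong₂ _+ᵠ_ (≡0⇒*-zeroˡ (G (n -ᶻ (T +ᶻ + 1) +ᶻ + 0)) (v _ (subst (T <ᶻ_) (sym (ZP.+-identityʳ (T +ᶻ + 1))) (i<i+1 T))))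
                    (sumTo-cong K (λ i _ → cong₂ _*ᵠ_ (cong F (shift-left T i)) (cong G (shift-right n T i)))) ⟩
    0ℚ +ᵠ conv F G T n K
      ≡⟨ QP.+-identityˡ _ ⟩
    conv F G T n K ∎)
  where
  open ≡-Reasoning
  shift-left : ∀ T i → (T +ᶻ + 1) -ᶻ + suc i ≡ T -ᶻ + i
  shift-left T i = trans (cong ((T +ᶻ + 1) -ᶻ_) (ZP.pos-+ 1 i)) (ring T (+ i))
    where
    ring : ∀ T i → (T +ᶻ + 1) -ᶻ (+ 1 +ᶻ i) ≡ T -ᶻ i
    ring = solve-∀
  shift-right : ∀ n T i → n -ᶻ (T +ᶻ + 1) +ᶻ + suc i ≡ n -ᶻ T +ᶻ + i
  shift-right n T i = trans (cong (n -ᶻ (T +ᶻ + 1) +ᶻ_) (ZP.pos-+ 1 i)) (ring n T (+ i))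
    where
    ring : ∀ n T i → n -ᶻ (T +ᶻ + 1) +ᶻ (+ 1 +ᶻ i) ≡ n -ᶻ T +ᶻ i
    ring = solve-∀

conv-raise : ∀ F G n j T K → VanishesAbove F T → conv F G T n K ≡ conv F G (T +ᶻ + j) n (K + j)
conv-raise F G n zero T K v = cong₂ (λ a b → conv F G a n b) (sym (ZP.+-identityʳ T)) (sym (NP.+-identityʳ K))
conv-raise F G n (suc j) T K v =
  trans (conv-raise-suc F G T n K v)
  (trans (conv-raise F G n j (T +ᶻ + 1) (suc K) (VanishesAbove-mono (ZP.<⇒≤ (i<i+1 T)) v))
    (cong₂ (λ a b → conv F G a n b) (ZP.+-assoc T (+ 1) (+ j)) (sym (NP.+-suc K j))))

conv-lengthen : ∀ F G T n K j → VanishesAbove G (n -ᶻ T +ᶻ + K) → conv F G T n K ≡ conv F G T n (K + j)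
conv-lengthen F G T n K j v =
  sym (sumTo-extend K j _ (λ i K<i → ≡0⇒*-zeroʳ (F (T -ᶻ + i)) (v _ (ZP.+-monoʳ-< (n -ᶻ T) (+<+ K<i)))))

conv-length-independent : ∀ F G T n K₁ K₂ → VanishesAbove G (n -ᶻ T +ᶻ + K₁) → VanishesAbove G (n -ᶻ T +ᶻ + K₂) →
  conv F G T n K₁ ≡ conv F G T n K₂
conv-length-independent F G T n K₁ K₂ v₁ v₂ with NP.≤-total K₁ K₂
... | inj₁ p = trans (conv-lengthen F G T n K₁ (K₂ ∸ K₁) v₁) (cong (conv F G T n) (NP.m+[n∸m]≡n p))
... | inj₂ p = sym (trans (conv-lengthen F G T n K₂ (K₁ ∸ K₂) v₂) (cong (conv F G T n) (NP.m+[n∸m]≡n p)))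

conv-window-independent : ∀ F G n T K T′ K′ → VanishesAbove F T → VanishesAbove G (n -ᶻ T +ᶻ + K) →
  VanishesAbove F T′ → VanishesAbove G (n -ᶻ T′ +ᶻ + K′) → conv F G T n K ≡ conv F G T′ n K′
conv-window-independent F G n T K T′ K′ vf vg vf′ vg′ with ZP.≤-total T T′
... | inj₁ p with ≤⇒offset p
...   | j , refl = trans (conv-raise F G n j T K vf)
          (conv-length-independent F G (T +ᶻ + j) n (K + j) K′ (subst (VanishesAbove G) (shift n T (+ j) (+ K)) vg) vg′)
  where
  shift : ∀ n T j K → n -ᶻ T +ᶻ K ≡ n -ᶻ (T +ᶻ j) +ᶻ (K +ᶻ j)
  shift = solve-∀
conv-window-independent F G n T K T′ K′ vf vg vf′ vg′ | inj₂ p with ≤⇒offset p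
...   | j , refl = sym (trans (conv-raise F G n j T′ K′ vf′)
          (conv-length-independent F G (T′ +ᶻ + j) n (K′ + j) K (subst (VanishesAbove G) (shift n T′ (+ j) (+ K′)) vg′) vg))
  where
  shift : ∀ n T j K → n -ᶻ T +ᶻ K ≡ n -ᶻ (T +ᶻ j) +ᶻ (K +ᶻ j)
  shift = solve-∀

conv-above-degree : ∀ F G T₀ U₀ T n K → VanishesAbove F T₀ → VanishesAbove G U₀ → T₀ +ᶻ U₀ <ᶻ n → conv F G T n K ≡ 0ℚ
conv-above-degree F G T₀ U₀ T n K vf vg p = sumTo-0 K λ i _ → term i
  where
  indices-sum : ∀ T i n → (T -ᶻ i) +ᶻ (n -ᶻ T +ᶻ i) ≡ n
  indices-sum = solve-∀
  term : ∀ i → F (T -ᶻ + i) *ᵠ G (n -ᶻ T +ᶻ + i) ≡ 0ℚ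
  term i with ≤⊎> (T -ᶻ + i) T₀ | ≤⊎> (n -ᶻ T +ᶻ + i) U₀
  ... | inj₂ q | _      = ≡0⇒*-zeroˡ (G (n -ᶻ T +ᶻ + i)) (vf _ q)
  ... | inj₁ _ | inj₂ r = ≡0⇒*-zeroʳ (F (T -ᶻ + i)) (vg _ r)
  ... | inj₁ q | inj₁ r = ⊥-elim (ZP.<⇒≱ p (subst (_≤ᶻ T₀ +ᶻ U₀) (indices-sum T (+ i) n) (ZP.+-mono-≤ q r)))

coeffAt-*S : ∀ f g n T K → VanishesAbove (coeffAt f) T → VanishesAbove (coeffAt g) (n -ᶻ T +ᶻ + K) → coeffAt (f *S g) n ≡ conv (coeffAt f) (coeffAt g) T n K
coeffAt-*S (mk T0 c) (mk U0 e) n T K vf vg with ≤⊎> n (T0 +ᶻ U0)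
... | inj₁ p = trans (coeffAt-*S-canonical T0 c U0 e n p)
   (conv-window-independent (coeffAt (mk T0 c)) (coeffAt (mk U0 e)) n T0 k0 T K (vanishesAbove-top (mk T0 c)) (subst (VanishesAbove (coeffAt (mk U0 e))) (sym w) (vanishesAbove-top (mk U0 e))) vf vg)
  where
  k0 = ∣ (T0 +ᶻ U0) -ᶻ n ∣
  ring′ : ∀ n T0 U0 → n -ᶻ T0 +ᶻ ((T0 +ᶻ U0) -ᶻ n) ≡ U0
  ring′ = solve-∀
  w : n -ᶻ T0 +ᶻ + k0 ≡ U0
  w = trans (cong (n -ᶻ T0 +ᶻ_) (+∣T-n∣≡T-n p)) (ring′ n T0 U0)
... | inj₂ p = trans (vanishesAbove-top (mk T0 c *S mk U0 e) n p) (sym (conv-above-degree _ _ T0 U0 T n K (vanishesAbove-top (mk T0 c)) (vanishesAbove-top (mk U0 e)) p))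

-- The commutative ring of series

negS : Series → Series
negS (mk T c) = mk T (λ k → -ᵠ c k)

coeffAt-negS : ∀ f n → coeffAt (negS f) n ≡ -ᵠ coeffAt f n
coeffAt-negS (mk T c) n with ≤⊎> n T
... | inj₁ p = trans (coeffAt-≤top T _ n p) (cong -ᵠ_ (sym (coeffAt-≤top T c n p)))
... | inj₂ p = trans (vanishesAbove-top (negS (mk T c)) n p) (cong -ᵠ_ (sym (vanishesAbove-top (mk T c) n p)))

VanishesAbove-+ : ∀ f g → VanishesAbove (λ n → coeffAt f n +ᵠ coeffAt g n) (top f ⊔ top g)
VanishesAbove-+ f g n p = trans (cong₂ _+ᵠ_ (vanishesAbove-top f n (ZP.≤-<-trans (ZP.i≤i⊔j (top f) (top g)) p))
                                  (vanishesAbove-top g n (ZP.≤-<-trans (ZP.i≤j⊔i (top f) (top g)) p))) (QP.+-identityʳ 0ℚ)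

coeffAt-+S : ∀ f g n → coeffAt (f +S g) n ≡ coeffAt f n +ᵠ coeffAt g n
coeffAt-+S f g n = coeffAt-fromFn-vanishing _ _ (VanishesAbove-+ f g) n

coeffAt-zeroS : ∀ n → coeffAt zeroS n ≡ 0ℚ
coeffAt-zeroS n = coeffAt-fromFn-vanishing (+ 0) (λ _ → 0ℚ) (λ _ _ → refl) n

coeffAt-oneS-0 : coeffAt oneS (+ 0) ≡ 1ℚ
coeffAt-oneS-0 = refl

coeffAt-oneS : ∀ n → ¬ (n ≡ + 0) → coeffAt oneS n ≡ 0ℚ
coeffAt-oneS n nz with ≤⊎> n (+ 0)
... | inj₂ p = vanishesAbove-top oneS n p
... | inj₁ p with ∣ + 0 -ᶻ n ∣ in eq
...   | suc _ = trans (coeffAt-≤top (+ 0) _ n p) (cong (λ k → coeff oneS k) eq)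
...   | zero = ⊥-elim (nz (trans (sym (T-+∣T-n∣≡n p)) (cong (λ k → + 0 -ᶻ + k) eq)))

VanishesAbove-*S : ∀ f g → VanishesAbove (coeffAt (f *S g)) (top f +ᶻ top g)
VanishesAbove-*S f@(mk _ _) g@(mk _ _) = vanishesAbove-top (f *S g)

window : ∀ n T U → Σ ℕ λ K → U ≤ᶻ n -ᶻ T +ᶻ + K
window n T U with ≤⊎> U (n -ᶻ T)
... | inj₁ p = 0 , subst (U ≤ᶻ_) (sym (ZP.+-identityʳ (n -ᶻ T))) p
... | inj₂ p = ∣ U -ᶻ (n -ᶻ T) ∣ , ZP.≤-reflexive (sym (trans (cong (n -ᶻ T +ᶻ_) (+∣T-n∣≡T-n (ZP.<⇒≤ p))) (ring (n -ᶻ T) U)))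
  where
  ring : ∀ x U → x +ᶻ (U -ᶻ x) ≡ U
  ring = solve-∀

VanishesAbove-≈ : ∀ {f g T} → f ≈ g → VanishesAbove (coeffAt f) T → VanishesAbove (coeffAt g) T
VanishesAbove-≈ e v n p = trans (sym (e n)) (v n p)

conv-cong : ∀ {F F' G G'} T n K → (∀ m → F m ≡ F' m) → (∀ m → G m ≡ G' m) → conv F G T n K ≡ conv F' G' T n K
conv-cong T n K eF eG = sumTo-cong K (λ i _ → cong₂ _*ᵠ_ (eF _) (eG _))

*S-cong : ∀ {f f' g g'} → f ≈ f' → g ≈ g' → f *S g ≈ f' *S g'
*S-cong {f} {f'} {g} {g'} ef eg n with window n (top f) (top g)
... | K , w = trans (coeffAt-*S f g n (top f) K (vanishesAbove-top f) (VanishesAbove-mono w (vanishesAbove-top g)))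
    (trans (conv-cong (top f) n K ef eg)
      (sym (coeffAt-*S f' g' n (top f) K (VanishesAbove-≈ ef (vanishesAbove-top f)) (VanishesAbove-mono w (VanishesAbove-≈ eg (vanishesAbove-top g))))))

+S-cong : ∀ {f f' g g'} → f ≈ f' → g ≈ g' → f +S g ≈ f' +S g'
+S-cong {f} {f'} {g} {g'} ef eg n = trans (coeffAt-+S f g n) (trans (cong₂ _+ᵠ_ (ef n) (eg n)) (sym (coeffAt-+S f' g' n)))

neg-cong : ∀ {f f'} → f ≈ f' → negS f ≈ negS f'
neg-cong {f} {f'} ef n = trans (coeffAt-negS f n) (trans (cong -ᵠ_ (ef n)) (sym (coeffAt-negS f' n)))

+S-assoc : ∀ f g h → (f +S g) +S h ≈ f +S (g +S h)
+S-assoc f g h n = trans (coeffAt-+S _ h n) (trans (cong (_+ᵠ coeffAt h n) (coeffAt-+S f g n))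
  (trans (QP.+-assoc (coeffAt f n) (coeffAt g n) (coeffAt h n)) (sym (trans (coeffAt-+S f _ n) (cong (coeffAt f n +ᵠ_) (coeffAt-+S g h n))))))

+S-comm : ∀ f g → f +S g ≈ g +S f
+S-comm f g n = trans (coeffAt-+S f g n) (trans (QP.+-comm (coeffAt f n) (coeffAt g n)) (sym (coeffAt-+S g f n)))

+S-idˡ : ∀ f → zeroS +S f ≈ f
+S-idˡ f n = trans (coeffAt-+S zeroS f n) (trans (cong (_+ᵠ coeffAt f n) (coeffAt-zeroS n)) (QP.+-identityˡ (coeffAt f n)))

+S-idʳ : ∀ f → f +S zeroS ≈ f
+S-idʳ f n = trans (coeffAt-+S f zeroS n) (trans (cong (coeffAt f n +ᵠ_) (coeffAt-zeroS n)) (QP.+-identityʳ (coeffAt f n)))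

+S-invˡ : ∀ f → negS f +S f ≈ zeroS
+S-invˡ f n = trans (coeffAt-+S (negS f) f n) (trans (cong (_+ᵠ coeffAt f n) (coeffAt-negS f n)) (trans (QP.+-inverseˡ (coeffAt f n)) (sym (coeffAt-zeroS n))))

+S-invʳ : ∀ f → f +S negS f ≈ zeroS
+S-invʳ f n = trans (coeffAt-+S f (negS f) n) (trans (cong (coeffAt f n +ᵠ_) (coeffAt-negS f n)) (trans (QP.+-inverseʳ (coeffAt f n)) (sym (coeffAt-zeroS n))))

*S-idˡ : ∀ g → oneS *S g ≈ g
*S-idˡ g n with window n (+ 0) (top g)
... | K , w = trans (coeffAt-*S oneS g n (+ 0) K (vanishesAbove-top oneS) (VanishesAbove-mono w (vanishesAbove-top g)))
   (trans (sumTo-first K _ (λ { (suc j) _ _ → ≡0⇒*-zeroˡ (coeffAt g (n -ᶻ + 0 +ᶻ + suc j)) (coeffAt-oneS (+ 0 -ᶻ + suc j) (λ ())) }))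
     (trans (QP.*-identityˡ _) (cong (coeffAt g) (ring n))))
  where
  ring : ∀ n → n -ᶻ + 0 +ᶻ + 0 ≡ n
  ring = solve-∀

*S-comm : ∀ f g → f *S g ≈ g *S f
*S-comm (mk T c) (mk U e) n with ≤⊎> n (T +ᶻ U)
... | inj₂ p = trans (vanishesAbove-top (mk T c *S mk U e) n p) (sym (vanishesAbove-top (mk U e *S mk T c) n (subst (_<ᶻ n) (ZP.+-comm T U) p)))
... | inj₁ p = begin
    coeffAt (f *S g) n ≡⟨ coeffAt-*S f g n T K (vanishesAbove-top f) (subst (VanishesAbove (coeffAt g)) (sym w1) (vanishesAbove-top g)) ⟩
    conv (coeffAt f) (coeffAt g) T n K ≡⟨ sumTo-rev K (λ i → coeffAt f (T -ᶻ + i) *ᵠ coeffAt g (n -ᶻ T +ᶻ + i)) ⟩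
    sumTo K (λ i → coeffAt f (T -ᶻ + (K ∸ i)) *ᵠ coeffAt g (n -ᶻ T +ᶻ + (K ∸ i)))
      ≡⟨ sumTo-cong K (λ i q → trans (QP.*-comm (coeffAt f (T -ᶻ + (K ∸ i))) (coeffAt g (n -ᶻ T +ᶻ + (K ∸ i)))) (cong₂ _*ᵠ_ (cong (coeffAt g) (i1 i q)) (cong (coeffAt f) (i2 i q)))) ⟩
    conv (coeffAt g) (coeffAt f) U n K ≡⟨ sym (coeffAt-*S g f n U K (vanishesAbove-top g) (subst (VanishesAbove (coeffAt f)) (sym w2) (vanishesAbove-top f))) ⟩
    coeffAt (g *S f) n ∎
  where
  open ≡-Reasoning
  f = mk T c
  g = mk U e
  K = ∣ (T +ᶻ U) -ᶻ n ∣
  kk : + K ≡ (T +ᶻ U) -ᶻ n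
  kk = +∣T-n∣≡T-n p
  ring₁ : ∀ n T U → n -ᶻ T +ᶻ ((T +ᶻ U) -ᶻ n) ≡ U
  ring₁ = solve-∀
  ring₂ : ∀ n T U → n -ᶻ U +ᶻ ((T +ᶻ U) -ᶻ n) ≡ T
  ring₂ = solve-∀
  w1 : n -ᶻ T +ᶻ + K ≡ U
  w1 = trans (cong (n -ᶻ T +ᶻ_) kk) (ring₁ n T U)
  w2 : n -ᶻ U +ᶻ + K ≡ T
  w2 = trans (cong (n -ᶻ U +ᶻ_) kk) (ring₂ n T U)
  ring₃ : ∀ n T U i → n -ᶻ T +ᶻ (((T +ᶻ U) -ᶻ n) -ᶻ i) ≡ U -ᶻ i
  ring₃ = solve-∀
  ring₄ : ∀ n T U i → T -ᶻ (((T +ᶻ U) -ᶻ n) -ᶻ i) ≡ n -ᶻ U +ᶻ i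
  ring₄ = solve-∀
  i1 : ∀ i → i ≤ K → n -ᶻ T +ᶻ + (K ∸ i) ≡ U -ᶻ + i
  i1 i q = trans (cong (n -ᶻ T +ᶻ_) (trans (+[m∸n]≡+m-+n q) (cong (_-ᶻ + i) kk))) (ring₃ n T U (+ i))
  i2 : ∀ i → i ≤ K → T -ᶻ + (K ∸ i) ≡ n -ᶻ U +ᶻ + i
  i2 i q = trans (cong (T -ᶻ_) (trans (+[m∸n]≡+m-+n q) (cong (_-ᶻ + i) kk))) (ring₄ n T U (+ i))

*S-distribˡ : ∀ f g h → f *S (g +S h) ≈ f *S g +S f *S h
*S-distribˡ f g h n with window n (top f) (top g ⊔ top h)
... | K , w = begin
    coeffAt (f *S (g +S h)) n ≡⟨ coeffAt-*S f (g +S h) n (top f) K (vanishesAbove-top f) (VanishesAbove-mono w (vanishesAbove-top (g +S h))) ⟩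
    conv (coeffAt f) (coeffAt (g +S h)) (top f) n K ≡⟨ conv-cong {coeffAt f} {coeffAt f} {coeffAt (g +S h)} {λ m → coeffAt g m +ᵠ coeffAt h m} (top f) n K (λ _ → refl) (coeffAt-+S g h) ⟩
    sumTo K (λ i → coeffAt f (top f -ᶻ + i) *ᵠ (coeffAt g (n -ᶻ top f +ᶻ + i) +ᵠ coeffAt h (n -ᶻ top f +ᶻ + i)))
      ≡⟨ sumTo-cong K (λ i _ → QP.*-distribˡ-+ (coeffAt f (top f -ᶻ + i)) (coeffAt g (n -ᶻ top f +ᶻ + i)) (coeffAt h (n -ᶻ top f +ᶻ + i))) ⟩
    sumTo K (λ i → coeffAt f (top f -ᶻ + i) *ᵠ coeffAt g (n -ᶻ top f +ᶻ + i) +ᵠ coeffAt f (top f -ᶻ + i) *ᵠ coeffAt h (n -ᶻ top f +ᶻ + i))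
      ≡⟨ sumTo-+ K (λ i → coeffAt f (top f -ᶻ + i) *ᵠ coeffAt g (n -ᶻ top f +ᶻ + i)) (λ i → coeffAt f (top f -ᶻ + i) *ᵠ coeffAt h (n -ᶻ top f +ᶻ + i)) ⟩
    conv (coeffAt f) (coeffAt g) (top f) n K +ᵠ conv (coeffAt f) (coeffAt h) (top f) n K
      ≡⟨ cong₂ _+ᵠ_ (sym (coeffAt-*S f g n (top f) K (vanishesAbove-top f) (VanishesAbove-mono (ZP.≤-trans (ZP.i≤i⊔j (top g) (top h)) w) (vanishesAbove-top g))))
                    (sym (coeffAt-*S f h n (top f) K (vanishesAbove-top f) (VanishesAbove-mono (ZP.≤-trans (ZP.i≤j⊔i (top g) (top h)) w) (vanishesAbove-top h)))) ⟩
    coeffAt (f *S g) n +ᵠ coeffAt (f *S h) n ≡⟨ sym (coeffAt-+S (f *S g) (f *S h) n) ⟩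
    coeffAt (f *S g +S f *S h) n ∎
  where open ≡-Reasoning

module Associativity (f g h : Series) (n : ℤ) (K : ℕ) (w : top h ≤ᶻ n -ᶻ (top f +ᶻ top g) +ᶻ + K) where
  open ≡-Reasoning

  T = top f
  U = top g
  F = coeffAt f
  G = coeffAt g
  H = coeffAt h

  term : ℕ → ℕ → ℚ
  term j l = F (T -ᶻ + j) *ᵠ G (U -ᶻ + l) *ᵠ H (n -ᶻ (T +ᶻ U) +ᶻ + j +ᶻ + l)

  coeffAt-left : coeffAt ((f *S g) *S h) n ≡ sumTo K (λ i → sumTo i (λ j → term j (i ∸ j)))
  coeffAt-left = begin
    coeffAt ((f *S g) *S h) n
      ≡⟨ coeffAt-*S (f *S g) h n (T +ᶻ U) K (VanishesAbove-*S f g) (VanishesAbove-mono w (vanishesAbove-top h)) ⟩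
    sumTo K (λ i → coeffAt (f *S g) ((T +ᶻ U) -ᶻ + i) *ᵠ H (n -ᶻ (T +ᶻ U) +ᶻ + i))
      ≡⟨ sumTo-cong K (λ i _ → cong (_*ᵠ H (n -ᶻ (T +ᶻ U) +ᶻ + i))
           (coeffAt-*S f g ((T +ᶻ U) -ᶻ + i) T i (vanishesAbove-top f) (subst (VanishesAbove G) (sym (window-g i)) (vanishesAbove-top g)))) ⟩
    sumTo K (λ i → sumTo i (λ j → F (T -ᶻ + j) *ᵠ G ((T +ᶻ U) -ᶻ + i -ᶻ T +ᶻ + j)) *ᵠ H (n -ᶻ (T +ᶻ U) +ᶻ + i))
      ≡⟨ sumTo-cong K (λ i _ → sym (sumTo-*ʳ i (H (n -ᶻ (T +ᶻ U) +ᶻ + i)) (λ j → F (T -ᶻ + j) *ᵠ G ((T +ᶻ U) -ᶻ + i -ᶻ T +ᶻ + j)))) ⟩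
    sumTo K (λ i → sumTo i (λ j → F (T -ᶻ + j) *ᵠ G ((T +ᶻ U) -ᶻ + i -ᶻ T +ᶻ + j) *ᵠ H (n -ᶻ (T +ᶻ U) +ᶻ + i)))
      ≡⟨ sumTo-cong K (λ i _ → sumTo-cong i (λ j j≤i → cong₂ (λ a b → F (T -ᶻ + j) *ᵠ G a *ᵠ H b) (index-g i j j≤i) (index-h i j j≤i))) ⟩
    sumTo K (λ i → sumTo i (λ j → term j (i ∸ j))) ∎
    where
    ring₁ : ∀ T U i → (T +ᶻ U) -ᶻ i -ᶻ T +ᶻ i ≡ U
    ring₁ = solve-∀
    window-g : ∀ i → (T +ᶻ U) -ᶻ + i -ᶻ T +ᶻ + i ≡ U
    window-g i = ring₁ T U (+ i)
    ring₂ : ∀ T U i j → (T +ᶻ U) -ᶻ i -ᶻ T +ᶻ j ≡ U -ᶻ (i -ᶻ j)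
    ring₂ = solve-∀
    index-g : ∀ i j → j ≤ i → (T +ᶻ U) -ᶻ + i -ᶻ T +ᶻ + j ≡ U -ᶻ + (i ∸ j)
    index-g i j j≤i = trans (ring₂ T U (+ i) (+ j)) (cong (U -ᶻ_) (sym (+[m∸n]≡+m-+n j≤i)))
    ring₃ : ∀ x i j → x +ᶻ i ≡ x +ᶻ j +ᶻ (i -ᶻ j)
    ring₃ = solve-∀
    index-h : ∀ i j → j ≤ i → n -ᶻ (T +ᶻ U) +ᶻ + i ≡ n -ᶻ (T +ᶻ U) +ᶻ + j +ᶻ + (i ∸ j)
    index-h i j j≤i = trans (ring₃ (n -ᶻ (T +ᶻ U)) (+ i) (+ j)) (cong (n -ᶻ (T +ᶻ U) +ᶻ + j +ᶻ_) (sym (+[m∸n]≡+m-+n j≤i)))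

  coeffAt-right : coeffAt (f *S (g *S h)) n ≡ sumTo K (λ j → sumTo (K ∸ j) (term j))
  coeffAt-right = begin
    coeffAt (f *S (g *S h)) n
      ≡⟨ coeffAt-*S f (g *S h) n T K (vanishesAbove-top f) (VanishesAbove-mono window-gh (VanishesAbove-*S g h)) ⟩
    sumTo K (λ j → F (T -ᶻ + j) *ᵠ coeffAt (g *S h) (n -ᶻ T +ᶻ + j))
      ≡⟨ sumTo-cong K inner ⟩
    sumTo K (λ j → sumTo (K ∸ j) (term j)) ∎
    where
    ring₄ : ∀ n T U j l → n -ᶻ (T +ᶻ U) +ᶻ j +ᶻ l ≡ n -ᶻ T +ᶻ j -ᶻ U +ᶻ l
    ring₄ = solve-∀
    ring₅ : ∀ n T U j K → n -ᶻ (T +ᶻ U) +ᶻ K ≡ n -ᶻ T +ᶻ j -ᶻ U +ᶻ (K -ᶻ j)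
    ring₅ = solve-∀
    window-h : ∀ j → j ≤ K → top h ≤ᶻ n -ᶻ T +ᶻ + j -ᶻ U +ᶻ + (K ∸ j)
    window-h j j≤K = subst (top h ≤ᶻ_) (trans (ring₅ n T U (+ j) (+ K)) (cong (n -ᶻ T +ᶻ + j -ᶻ U +ᶻ_) (sym (+[m∸n]≡+m-+n j≤K)))) w
    ring₆ : ∀ n T U K → U +ᶻ (n -ᶻ (T +ᶻ U) +ᶻ K) ≡ n -ᶻ T +ᶻ K
    ring₆ = solve-∀
    window-gh : U +ᶻ top h ≤ᶻ n -ᶻ T +ᶻ + K
    window-gh = subst (U +ᶻ top h ≤ᶻ_) (ring₆ n T U (+ K)) (ZP.+-monoʳ-≤ U w)
    inner : ∀ j → j ≤ K → F (T -ᶻ + j) *ᵠ coeffAt (g *S h) (n -ᶻ T +ᶻ + j) ≡ sumTo (K ∸ j) (term j)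
    inner j j≤K = sym (begin
      sumTo (K ∸ j) (term j)
        ≡⟨ sumTo-cong (K ∸ j) (λ l _ → trans (QP.*-assoc (F (T -ᶻ + j)) (G (U -ᶻ + l)) (H (n -ᶻ (T +ᶻ U) +ᶻ + j +ᶻ + l)))
                                             (cong (λ z → F (T -ᶻ + j) *ᵠ (G (U -ᶻ + l) *ᵠ H z)) (ring₄ n T U (+ j) (+ l)))) ⟩
      sumTo (K ∸ j) (λ l → F (T -ᶻ + j) *ᵠ (G (U -ᶻ + l) *ᵠ H (n -ᶻ T +ᶻ + j -ᶻ U +ᶻ + l)))
        ≡⟨ sumTo-*ˡ (K ∸ j) (F (T -ᶻ + j)) (λ l → G (U -ᶻ + l) *ᵠ H (n -ᶻ T +ᶻ + j -ᶻ U +ᶻ + l)) ⟩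
      F (T -ᶻ + j) *ᵠ conv G H U (n -ᶻ T +ᶻ + j) (K ∸ j)
        ≡⟨ cong (F (T -ᶻ + j) *ᵠ_) (sym (coeffAt-*S g h (n -ᶻ T +ᶻ + j) U (K ∸ j) (vanishesAbove-top g) (VanishesAbove-mono (window-h j j≤K) (vanishesAbove-top h)))) ⟩
      F (T -ᶻ + j) *ᵠ coeffAt (g *S h) (n -ᶻ T +ᶻ + j) ∎)

*S-assoc : ∀ f g h → (f *S g) *S h ≈ f *S (g *S h)
*S-assoc f g h n with window n (top f +ᶻ top g) (top h)
... | K , w = trans coeffAt-left (trans (sumTo-triangle K term) (sym coeffAt-right))
  where open Associativity f g h n K w

*S-idʳ : ∀ g → g *S oneS ≈ g
*S-idʳ g n = trans (*S-comm g oneS n) (*S-idˡ g n)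

*S-distribʳ : ∀ f g h → (g +S h) *S f ≈ g *S f +S h *S f
*S-distribʳ f g h n = trans (*S-comm (g +S h) f n) (trans (*S-distribˡ f g h n)
   (+S-cong {f *S g} {g *S f} {f *S h} {h *S f} (*S-comm f g) (*S-comm f h) n))

≈-isEquivalence : IsEquivalence _≈_
≈-isEquivalence = record { refl = λ _ → refl ; sym = λ e n → sym (e n) ; trans = λ e1 e2 n → trans (e1 n) (e2 n) }

Series-isCommutativeRing : IsCommutativeRing _≈_ _+S_ _*S_ negS zeroS oneS
Series-isCommutativeRing = record
  { isRing = record
    { +-isAbelianGroup = record
      { isGroup = record
        { isMonoid = record
          { isSemigroup = record
            { isMagma = record { isEquivalence = ≈-isEquivalence ; ∙-cong = +S-cong }
            ; assoc = +S-assoc }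
          ; identity = +S-idˡ , +S-idʳ }
        ; inverse = +S-invˡ , +S-invʳ
        ; ⁻¹-cong = neg-cong }
      ; comm = +S-comm }
    ; *-cong = *S-cong
    ; *-assoc = *S-assoc
    ; *-identity = *S-idˡ , *S-idʳ
    ; distrib = *S-distribˡ , *S-distribʳ }
  ; *-comm = *S-comm }

Series-commutativeRing : CommutativeRing _ _
Series-commutativeRing = record { isCommutativeRing = Series-isCommutativeRing }

constS : ℚ → Series
constS x = mk (+ 0) (λ { zero → x ; (suc _) → 0ℚ })

coeffAt-constS : ∀ x n → ¬ (n ≡ + 0) → coeffAt (constS x) n ≡ 0ℚ
coeffAt-constS x n nz with ≤⊎> n (+ 0)
... | inj₂ p = vanishesAbove-top (constS x) n p
... | inj₁ p with ∣ + 0 -ᶻ n ∣ in eq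
...   | suc _ = trans (coeffAt-≤top (+ 0) _ n p) (cong (λ k → coeff (constS x) k) eq)
...   | zero = ⊥-elim (nz (trans (sym (T-+∣T-n∣≡n p)) (cong (λ k → + 0 -ᶻ + k) eq)))

constS-+ : ∀ x y → constS (x +ᵠ y) ≈ constS x +S constS y
constS-+ x y n with n ZP.≟ + 0
... | yes refl = sym (coeffAt-+S (constS x) (constS y) (+ 0))
... | no nz = trans (coeffAt-constS _ n nz) (sym (trans (coeffAt-+S (constS x) (constS y) n) (trans (cong₂ _+ᵠ_ (coeffAt-constS x n nz) (coeffAt-constS y n nz)) (QP.+-identityʳ 0ℚ))))

constS-neg : ∀ x → constS (-ᵠ x) ≈ negS (constS x)
constS-neg x n with n ZP.≟ + 0
... | yes refl = sym (coeffAt-negS (constS x) (+ 0))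
... | no nz = trans (coeffAt-constS _ n nz) (sym (trans (coeffAt-negS (constS x) n) (cong -ᵠ_ (coeffAt-constS x n nz))))

constS-* : ∀ x y → constS (x *ᵠ y) ≈ constS x *S constS y
constS-* x y n with window n (+ 0) (+ 0)
... | K , w = sym (trans (coeffAt-*S (constS x) (constS y) n (+ 0) K (vanishesAbove-top (constS x)) (VanishesAbove-mono w (vanishesAbove-top (constS y))))
     (trans (sumTo-first K _ (λ { (suc j) _ _ → ≡0⇒*-zeroˡ (coeffAt (constS y) (n -ᶻ + 0 +ᶻ + suc j)) (coeffAt-constS x (+ 0 -ᶻ + suc j) (λ ())) }))
       (trans (cong (x *ᵠ_) (cong (coeffAt (constS y)) (ring n))) (fin n))))
  where
  ring : ∀ n → n -ᶻ + 0 +ᶻ + 0 ≡ n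
  ring = solve-∀
  fin : ∀ n → x *ᵠ coeffAt (constS y) n ≡ coeffAt (constS (x *ᵠ y)) n
  fin n with n ZP.≟ + 0
  ... | yes refl = refl
  ... | no nz = trans (cong (x *ᵠ_) (coeffAt-constS y n nz)) (trans (QP.*-zeroʳ x) (sym (coeffAt-constS _ n nz)))

constS-0 : constS 0ℚ ≈ zeroS
constS-0 n with n ZP.≟ + 0
... | yes refl = refl
... | no nz = trans (coeffAt-constS 0ℚ n nz) (sym (coeffAt-zeroS n))

constS-1 : constS 1ℚ ≈ oneS
constS-1 n with n ZP.≟ + 0
... | yes refl = refl
... | no nz = trans (coeffAt-constS 1ℚ n nz) (sym (coeffAt-oneS n nz))

Series-almostCommutativeRing : ASR.AlmostCommutativeRing _ _
Series-almostCommutativeRing = ASR.fromCommutativeRing Series-commutativeRing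

constS-homomorphism : CommutativeRing.rawRing QP.+-*-commutativeRing ASR.-Raw-AlmostCommutative⟶ Series-almostCommutativeRing
constS-homomorphism = record { ⟦_⟧ = constS ; +-homo = constS-+ ; *-homo = constS-* ; -‿homo = constS-neg ; 0-homo = constS-0 ; 1-homo = constS-1 }

constS-≈? : ∀ x y → Maybe (constS x ≈ constS y)
constS-≈? x y with x QP.≟ y
... | yes refl = just (λ _ → refl)
... | no _ = nothing

module SeriesSolver = RSolver (CommutativeRing.rawRing QP.+-*-commutativeRing) Series-almostCommutativeRing constS-homomorphism constS-≈?
open SeriesSolver using (solve; _:=_; _:+_; _:*_; :-_)

-- Degrees

*-≢0 : ∀ {a b} → ¬ (a ≡ 0ℚ) → ¬ (b ≡ 0ℚ) → ¬ (a *ᵠ b ≡ 0ℚ)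
*-≢0 {a} {b} a≢0 b≢0 ab≡0 = b≢0 (begin
    b                  ≡⟨ sym (QP.*-identityˡ b) ⟩
    1ℚ *ᵠ b            ≡⟨ cong (_*ᵠ b) (sym (QP.*-inverseˡ a {{QB.≢-nonZero a≢0}})) ⟩
    a⁻¹ *ᵠ a *ᵠ b      ≡⟨ QP.*-assoc a⁻¹ a b ⟩
    a⁻¹ *ᵠ (a *ᵠ b)    ≡⟨ cong (a⁻¹ *ᵠ_) ab≡0 ⟩
    a⁻¹ *ᵠ 0ℚ          ≡⟨ QP.*-zeroʳ a⁻¹ ⟩
    0ℚ                 ∎)
  where
  open ≡-Reasoning
  a⁻¹ = (QB.1/ a) {{QB.≢-nonZero a≢0}}

*≢0⇒≢0ˡ : ∀ {a} b → ¬ (a *ᵠ b ≡ 0ℚ) → ¬ (a ≡ 0ℚ)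
*≢0⇒≢0ˡ b n refl = n (QP.*-zeroˡ b)

DegLe : Series → ℤ → Set
DegLe f m = VanishesAbove (coeffAt f) m

DegLe-+ : ∀ {f g m} → DegLe f m → DegLe g m → DegLe (f +S g) m
DegLe-+ {f} {g} vf vg n p = trans (coeffAt-+S f g n) (trans (cong₂ _+ᵠ_ (vf n p) (vg n p)) (QP.+-identityʳ 0ℚ))

DegLe-neg : ∀ {f m} → DegLe f m → DegLe (negS f) m
DegLe-neg {f} v n p = trans (coeffAt-negS f n) (cong -ᵠ_ (v n p))

DegLe-* : ∀ {f g a b} → DegLe f a → DegLe g b → DegLe (f *S g) (a +ᶻ b)
DegLe-* {f} {g} {a} {b} vf vg n p with window n a b
... | K , w = trans (coeffAt-*S f g n a K vf (VanishesAbove-mono w vg)) (conv-above-degree (coeffAt f) (coeffAt g) a b a n K vf vg p)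

DegLe-≈ : ∀ {f g m} → f ≈ g → DegLe f m → DegLe g m
DegLe-≈ = VanishesAbove-≈

HasDeg-≈ : ∀ {f g m} → f ≈ g → HasDeg f m → HasDeg g m
HasDeg-≈ {f} {g} {m} e (nz , v) = (λ z → nz (trans (e m) z)) , VanishesAbove-≈ e v

HasDeg⇒≤ : ∀ {f a b} → HasDeg f a → DegLe f b → a ≤ᶻ b
HasDeg⇒≤ {f} {a} {b} (nz , _) v with ≤⊎> a b
... | inj₁ p = p
... | inj₂ p = ⊥-elim (nz (v a p))

HasDeg-uniq : ∀ {f a b} → HasDeg f a → HasDeg f b → a ≡ b
HasDeg-uniq ha hb = ZP.≤-antisym (HasDeg⇒≤ ha (proj₂ hb)) (HasDeg⇒≤ hb (proj₂ ha))

HasDeg-neg : ∀ {f a} → HasDeg f a → HasDeg (negS f) a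
HasDeg-neg {f} {a} (nz , v) = (λ z → nz (QP.neg-injective (trans (sym (coeffAt-negS f a)) z))) , DegLe-neg v

HasDeg-* : ∀ {f g a b} → HasDeg f a → HasDeg g b → HasDeg (f *S g) (a +ᶻ b)
HasDeg-* {f} {g} {a} {b} (nf , vf) (ng , vg) = nz , DegLe-* vf vg
  where
  ring₁ : ∀ a b → (a +ᶻ b) -ᶻ a +ᶻ + 0 ≡ b
  ring₁ = solve-∀
  ring₂ : ∀ a → a -ᶻ + 0 ≡ a
  ring₂ = solve-∀
  nz : ¬ (coeffAt (f *S g) (a +ᶻ b) ≡ 0ℚ)
  nz z = *-≢0 nf ng (trans (cong₂ _*ᵠ_ (cong (coeffAt f) (sym (ring₂ a))) (cong (coeffAt g) (sym (ring₁ a b))))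
           (trans (sym (coeffAt-*S f g (a +ᶻ b) a 0 vf (subst (VanishesAbove (coeffAt g)) (sym (ring₁ a b)) vg))) z))

HasDeg-+ : ∀ {f g a b} → HasDeg f a → DegLe g b → b <ᶻ a → HasDeg (f +S g) a
HasDeg-+ {f} {g} {a} {b} (nf , vf) vg p =
  (λ z → nf (trans (sym (QP.+-identityʳ (coeffAt f a))) (trans (cong (coeffAt f a +ᵠ_) (sym (vg a p))) (trans (sym (coeffAt-+S f g a)) z)))) ,
  DegLe-+ vf (VanishesAbove-mono (ZP.<⇒≤ p) vg)

HasDeg-one : HasDeg oneS (+ 0)
HasDeg-one = (λ ()) , vanishesAbove-top oneS

degree-at-or-below : ∀ k F T → VanishesAbove F T → ¬ (F (T -ᶻ + k) ≡ 0ℚ) → Σ ℤ λ a → ¬ (F a ≡ 0ℚ) × VanishesAbove F a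
degree-at-or-below zero F T v nz = T , (λ z → nz (trans (cong F (ZP.+-identityʳ T)) z)) , v
degree-at-or-below (suc k) F T v nz with F T QP.≟ 0ℚ
... | no p = T , p , v
... | yes p = degree-at-or-below k F (T -ᶻ + 1) v' (subst (λ z → ¬ (F z ≡ 0ℚ)) (ring T (+ k)) nz)
  where
  ring : ∀ T k → T -ᶻ (+ 1 +ᶻ k) ≡ T -ᶻ + 1 -ᶻ k
  ring = solve-∀
  ring′ : ∀ T → T -ᶻ + 1 +ᶻ + 1 ≡ T
  ring′ = solve-∀
  v' : VanishesAbove F (T -ᶻ + 1)
  v' n q with <⇒offset q
  ... | zero , refl = trans (cong F (ring′ T)) p
  ... | suc j , refl = v _ (offset⇒< j (ring″ T (+ j)))
    where
    ring″ : ∀ T j → T -ᶻ + 1 +ᶻ (+ 1 +ᶻ (+ 1 +ᶻ j)) ≡ T +ᶻ (+ 1 +ᶻ j)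
    ring″ = solve-∀

invertible⇒HasDeg : ∀ X Y → X *S Y ≈ oneS → Σ ℤ λ a → HasDeg X a
invertible⇒HasDeg X Y e with window (+ 0) (top X) (top Y)
... | K , w with sumTo≢0⇒term≢0 K _ (λ z → QP.1≢0 (trans (sym (trans (e (+ 0)) coeffAt-oneS-0)) (trans (coeffAt-*S X Y (+ 0) (top X) K (vanishesAbove-top X) (VanishesAbove-mono w (vanishesAbove-top Y))) z)))
...   | i , _ , nzt with degree-at-or-below i (coeffAt X) (top X) (vanishesAbove-top X) (*≢0⇒≢0ˡ (coeffAt Y (+ 0 -ᶻ top X +ᶻ + i)) nzt)
...     | a , nz , v = a , nz , v

-- Substitution z ↦ zᵈ, for d = suc e (compose f 0 is a junk value)

coeff-compose-multiple : ∀ T c e j → coeff (compose (mk T c) (suc e)) (j * suc e) ≡ c j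
coeff-compose-multiple T c e j with suc e ∣? (j * suc e)
... | yes _ = cong c (m*n/n≡m j (suc e))
... | no nd = ⊥-elim (nd (n∣m*n j))

coeff-compose-nonmultiple : ∀ T c e i → ¬ (suc e ∣ i) → coeff (compose (mk T c) (suc e)) i ≡ 0ℚ
coeff-compose-nonmultiple T c e i nd with suc e ∣? i
... | yes p = ⊥-elim (nd p)
... | no _ = refl

coeffAt-compose : ∀ f e m → coeffAt (compose f (suc e)) (+ suc e *ᶻ m) ≡ coeffAt f m
coeffAt-compose (mk T c) e m with ≤⊎> m T
... | inj₁ p with ≤⇒offset p
...   | j , refl = begin
    coeffAt (compose (mk (m +ᶻ + j) c) (suc e)) (+ suc e *ᶻ m)
      ≡⟨ cong (coeffAt (compose (mk (m +ᶻ + j) c) (suc e))) eq1 ⟩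
    coeffAt (compose (mk (m +ᶻ + j) c) (suc e)) (+ suc e *ᶻ (m +ᶻ + j) -ᶻ + (j * suc e))
      ≡⟨ coeffAt-top∸ (+ suc e *ᶻ (m +ᶻ + j)) _ (j * suc e) ⟩
    coeff (compose (mk (m +ᶻ + j) c) (suc e)) (j * suc e)
      ≡⟨ coeff-compose-multiple (m +ᶻ + j) c e j ⟩
    c j ≡⟨ sym (coeffAt-top∸ (m +ᶻ + j) c j) ⟩
    coeffAt (mk (m +ᶻ + j) c) (m +ᶻ + j -ᶻ + j) ≡⟨ cong (coeffAt (mk (m +ᶻ + j) c)) (ring₂ m (+ j)) ⟩
    coeffAt (mk (m +ᶻ + j) c) m ∎
  where
  open ≡-Reasoning
  ring₁ : ∀ d m j → d *ᶻ m ≡ d *ᶻ (m +ᶻ j) -ᶻ j *ᶻ d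
  ring₁ = solve-∀
  eq1 : + suc e *ᶻ m ≡ + suc e *ᶻ (m +ᶻ + j) -ᶻ + (j * suc e)
  eq1 = trans (ring₁ (+ suc e) m (+ j)) (cong (λ z → + suc e *ᶻ (m +ᶻ + j) -ᶻ z) (sym (ZP.pos-* j (suc e))))
  ring₂ : ∀ m j → m +ᶻ j -ᶻ j ≡ m
  ring₂ = solve-∀
coeffAt-compose (mk T c) e m | inj₂ p with <⇒offset p
... | j , refl = trans (vanishesAbove-top (compose (mk T c) (suc e)) _ (offset⇒< (e + j * suc e) eq)) (sym (vanishesAbove-top (mk T c) _ p))
  where
  ring₁ : ∀ d T x → d *ᶻ (T +ᶻ x) ≡ d *ᶻ T +ᶻ x *ᶻ d
  ring₁ = solve-∀
  eq : + suc e *ᶻ (T +ᶻ + suc j) ≡ + suc e *ᶻ T +ᶻ + suc (e + j * suc e)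
  eq = trans (ring₁ (+ suc e) T (+ suc j)) (cong (+ suc e *ᶻ T +ᶻ_) (sym (ZP.pos-* (suc j) (suc e))))

coeffAt-compose-nonmultiple : ∀ f e n → (∀ m → ¬ (n ≡ + suc e *ᶻ m)) → coeffAt (compose f (suc e)) n ≡ 0ℚ
coeffAt-compose-nonmultiple (mk T c) e n nm with ≤⊎> n (+ suc e *ᶻ T)
... | inj₂ p = vanishesAbove-top (compose (mk T c) (suc e)) n p
... | inj₁ p with ≤⇒offset p
...   | k , eq = trans (cong (coeffAt (compose (mk T c) (suc e))) eqn) (trans (coeffAt-top∸ (+ suc e *ᶻ T) _ k) (coeff-compose-nonmultiple T c e k nd))
  where
  eqn : n ≡ + suc e *ᶻ T -ᶻ + k
  eqn = j≡i+k⇒i≡j-k eq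
  ring₂ : ∀ d T q → d *ᶻ T -ᶻ q *ᶻ d ≡ d *ᶻ (T -ᶻ q)
  ring₂ = solve-∀
  nd : ¬ (suc e ∣ k)
  nd (divides q refl) = nm (T -ᶻ + q) (trans eqn (trans (cong (λ z → + suc e *ᶻ T -ᶻ z) (ZP.pos-* q (suc e))) (ring₂ (+ suc e) T (+ q))))

i≤[1+e]*∣i∣ : ∀ e i → i ≤ᶻ + suc e *ᶻ + ∣ i ∣
i≤[1+e]*∣i∣ e (+ a)     = subst (+ a ≤ᶻ_) (ZP.pos-* (suc e) a) (+≤+ (NP.m≤n*m a (suc e)))
i≤[1+e]*∣i∣ e -[1+ a ] = -≤+

multiple-or-not : ∀ e n → (Σ ℤ λ m → n ≡ + suc e *ᶻ m) ⊎ (∀ m → ¬ (n ≡ + suc e *ᶻ m))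
multiple-or-not e n with ≤⇒offset (i≤[1+e]*∣i∣ e n)
... | k , eq with suc e ∣? k
...   | yes (divides q refl) = inj₁ (+ ∣ n ∣ -ᶻ + q , trans (j≡i+k⇒i≡j-k eq) (trans (cong (λ z → + suc e *ᶻ + ∣ n ∣ -ᶻ z) (ZP.pos-* q (suc e))) (ring₂ (+ suc e) (+ ∣ n ∣) (+ q))))
  where
  ring₂ : ∀ d T q → d *ᶻ T -ᶻ q *ᶻ d ≡ d *ᶻ (T -ᶻ q)
  ring₂ = solve-∀
...   | no nd = inj₂ λ m eqm → nd (divides ∣ + ∣ n ∣ -ᶻ m ∣ (trans (cong ∣_∣ (ring₃ (+ suc e) (+ ∣ n ∣) n m (+ k) eq eqm)) (trans (ZP.abs-* (+ suc e) (+ ∣ n ∣ -ᶻ m)) (NP.*-comm (suc e) _))))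
  where
  ring₁ : ∀ n k → k ≡ (n +ᶻ k) -ᶻ n
  ring₁ = solve-∀
  ring₂ : ∀ d T m → d *ᶻ T -ᶻ d *ᶻ m ≡ d *ᶻ (T -ᶻ m)
  ring₂ = solve-∀
  ring₃ : ∀ d T n m k → d *ᶻ T ≡ n +ᶻ k → n ≡ d *ᶻ m → k ≡ d *ᶻ (T -ᶻ m)
  ring₃ d T n m k eq eqm = trans (ring₁ n k) (trans (cong (_-ᶻ n) (sym eq)) (trans (cong (d *ᶻ T -ᶻ_) eqm) (ring₂ d T m)))

coeffAt-compose-view : ∀ e f n → (Σ ℤ λ m → n ≡ + suc e *ᶻ m × coeffAt (compose f (suc e)) n ≡ coeffAt f m) ⊎ (coeffAt (compose f (suc e)) n ≡ 0ℚ)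
coeffAt-compose-view e f n with multiple-or-not e n
... | inj₁ (m , refl) = inj₁ (m , refl , coeffAt-compose f e m)
... | inj₂ nm = inj₂ (coeffAt-compose-nonmultiple f e n nm)

compose-+S : ∀ e f g → compose (f +S g) (suc e) ≈ compose f (suc e) +S compose g (suc e)
compose-+S e f g n with multiple-or-not e n
... | inj₁ (m , refl) = trans (coeffAt-compose (f +S g) e m) (trans (coeffAt-+S f g m) (sym (trans (coeffAt-+S (compose f (suc e)) (compose g (suc e)) (+ suc e *ᶻ m)) (cong₂ _+ᵠ_ (coeffAt-compose f e m) (coeffAt-compose g e m)))))
... | inj₂ nm = trans (coeffAt-compose-nonmultiple (f +S g) e n nm) (sym (trans (coeffAt-+S (compose f (suc e)) (compose g (suc e)) n) (trans (cong₂ _+ᵠ_ (coeffAt-compose-nonmultiple f e n nm) (coeffAt-compose-nonmultiple g e n nm)) (QP.+-identityʳ 0ℚ))))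

compose-negS : ∀ e f → compose (negS f) (suc e) ≈ negS (compose f (suc e))
compose-negS e f n with multiple-or-not e n
... | inj₁ (m , refl) = trans (coeffAt-compose (negS f) e m) (trans (coeffAt-negS f m) (sym (trans (coeffAt-negS (compose f (suc e)) (+ suc e *ᶻ m)) (cong -ᵠ_ (coeffAt-compose f e m)))))
... | inj₂ nm = trans (coeffAt-compose-nonmultiple (negS f) e n nm) (sym (trans (coeffAt-negS (compose f (suc e)) n) (cong -ᵠ_ (coeffAt-compose-nonmultiple f e n nm))))

DegLe-compose : ∀ e {f m} → DegLe f m → DegLe (compose f (suc e)) (+ suc e *ᶻ m)
DegLe-compose e {f} {m} v n p with coeffAt-compose-view e f n
... | inj₂ z = z
... | inj₁ (m' , refl , eq) = trans eq (v m' q)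
  where
  q : m <ᶻ m'
  q with ≤⊎> m' m
  ... | inj₂ r = r
  ... | inj₁ r = ⊥-elim (ZP.<⇒≱ p (ZP.*-monoˡ-≤-nonNeg (+ suc e) r))

HasDeg-compose : ∀ e {f m} → HasDeg f m → HasDeg (compose f (suc e)) (+ suc e *ᶻ m)
HasDeg-compose e {f} {m} (nz , v) = (λ z → nz (trans (sym (coeffAt-compose f e m)) z)) , DegLe-compose e v

IsPoly-compose : ∀ e {f} → IsPoly f → IsPoly (compose f (suc e))
IsPoly-compose e {f} ip n p with coeffAt-compose-view e f n
... | inj₂ z = z
... | inj₁ (m' , refl , eq) = trans eq (ip m' q)
  where
  q : m' <ᶻ + 0
  q with ≤⊎> (+ 0) m'
  ... | inj₂ r = r
  ... | inj₁ r = ⊥-elim (ZP.<⇒≱ p (subst (_≤ᶻ + suc e *ᶻ m') (ZP.*-zeroʳ (+ suc e)) (ZP.*-monoˡ-≤-nonNeg (+ suc e) r)))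

-- Unlike _∣?_, this does not leave the decision procedure in goals that mention compose.
divides-or-not : ∀ d k → (d ∣ k) ⊎ ¬ (d ∣ k)
divides-or-not d k with d ∣? k
... | yes d∣k = inj₁ d∣k
... | no  d∤k = inj₂ d∤k

coeff-compose-*S : ∀ e T c U c′ k →
  coeff (compose (mk T c *S mk U c′) (suc e)) k ≡
  sumTo k (λ i → coeff (compose (mk T c) (suc e)) i *ᵠ coeff (compose (mk U c′) (suc e)) (k ∸ i))
coeff-compose-*S e T c U c′ k with divides-or-not (suc e) k
... | inj₁ (divides q refl) = sym (begin
    sumTo (q * d) (λ i → coeff cf i *ᵠ coeff cg (q * d ∸ i))
      ≡⟨ sumTo-multiples e q _ (λ i d∤i → ≡0⇒*-zeroˡ (coeff cg (q * d ∸ i)) (coeff-compose-nonmultiple T c e i d∤i)) ⟩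
    sumTo q (λ j → coeff cf (j * d) *ᵠ coeff cg (q * d ∸ j * d))
      ≡⟨ sumTo-cong q (λ j _ → cong₂ _*ᵠ_ (coeff-compose-multiple T c e j)
                                         (trans (cong (coeff cg) (sym (NP.*-distribʳ-∸ d q j))) (coeff-compose-multiple U c′ e (q ∸ j)))) ⟩
    sumTo q (λ j → c j *ᵠ c′ (q ∸ j))
      ≡⟨ sym (coeff-compose-multiple (T +ᶻ U) (coeff (mk T c *S mk U c′)) e q) ⟩
    coeff (compose (mk T c *S mk U c′) d) (q * d) ∎)
  where
  open ≡-Reasoning
  d = suc e
  cf = compose (mk T c) d
  cg = compose (mk U c′) d
... | inj₂ d∤k = trans (coeff-compose-nonmultiple (T +ᶻ U) (coeff (mk T c *S mk U c′)) e k d∤k) (sym (sumTo-0 k term))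
  where
  term : ∀ i → i ≤ k → coeff (compose (mk T c) (suc e)) i *ᵠ coeff (compose (mk U c′) (suc e)) (k ∸ i) ≡ 0ℚ
  term i i≤k with divides-or-not (suc e) i
  ... | inj₂ d∤i = ≡0⇒*-zeroˡ (coeff (compose (mk U c′) (suc e)) (k ∸ i)) (coeff-compose-nonmultiple T c e i d∤i)
  ... | inj₁ d∣i = ≡0⇒*-zeroʳ (coeff (compose (mk T c) (suc e)) i) (coeff-compose-nonmultiple U c′ e (k ∸ i) (λ d∣k∸i → d∤k (∣m∸n∣n⇒∣m (suc e) i≤k d∣k∸i d∣i)))

compose-*S : ∀ e f g → compose (f *S g) (suc e) ≈ compose f (suc e) *S compose g (suc e)
compose-*S e (mk T c) (mk U c′) n with ≤⊎> n (+ suc e *ᶻ (T +ᶻ U))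
... | inj₂ p = trans (vanishesAbove-top (compose (mk T c *S mk U c′) (suc e)) n p)
                     (sym (vanishesAbove-top (cf *S cg) n (subst (_<ᶻ n) (ZP.*-distribˡ-+ (+ suc e) T U) p)))
  where
  cf = compose (mk T c) (suc e)
  cg = compose (mk U c′) (suc e)
... | inj₁ p with ≤⇒offset p
...   | k , eq = begin
    coeffAt (compose fg d) n                          ≡⟨ cong (coeffAt (compose fg d)) n≡ ⟩
    coeffAt (compose fg d) (D *ᶻ (T +ᶻ U) -ᶻ + k)    ≡⟨ coeffAt-top∸ (D *ᶻ (T +ᶻ U)) _ k ⟩
    coeff (compose fg d) k                            ≡⟨ coeff-compose-*S e T c U c′ k ⟩
    sumTo k (λ i → coeff cf i *ᵠ coeff cg (k ∸ i))
      ≡⟨ sym (sumTo-cong k (λ i i≤k → cong₂ _*ᵠ_ (coeffAt-top∸ (D *ᶻ T) _ i)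
                                                (trans (cong (coeffAt cg) (index i i≤k)) (coeffAt-top∸ (D *ᶻ U) _ (k ∸ i))))) ⟩
    conv (coeffAt cf) (coeffAt cg) (D *ᶻ T) n k
      ≡⟨ sym (coeffAt-*S cf cg n (D *ᶻ T) k (vanishesAbove-top cf) (subst (VanishesAbove (coeffAt cg)) (sym window-top) (vanishesAbove-top cg))) ⟩
    coeffAt (cf *S cg) n ∎
  where
  open ≡-Reasoning
  d = suc e
  D = + suc e
  fg = mk T c *S mk U c′
  cf = compose (mk T c) d
  cg = compose (mk U c′) d
  n≡ : n ≡ D *ᶻ (T +ᶻ U) -ᶻ + k
  n≡ = j≡i+k⇒i≡j-k eq
  ring₁ : ∀ D T U k → D *ᶻ (T +ᶻ U) -ᶻ k -ᶻ D *ᶻ T +ᶻ k ≡ D *ᶻ U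
  ring₁ = solve-∀
  window-top : n -ᶻ D *ᶻ T +ᶻ + k ≡ D *ᶻ U
  window-top = trans (cong (λ z → z -ᶻ D *ᶻ T +ᶻ + k) n≡) (ring₁ D T U (+ k))
  ring₂ : ∀ D T U k i → D *ᶻ (T +ᶻ U) -ᶻ k -ᶻ D *ᶻ T +ᶻ i ≡ D *ᶻ U -ᶻ (k -ᶻ i)
  ring₂ = solve-∀
  index : ∀ i → i ≤ k → n -ᶻ D *ᶻ T +ᶻ + i ≡ D *ᶻ U -ᶻ + (k ∸ i)
  index i i≤k = trans (cong (λ z → z -ᶻ D *ᶻ T +ᶻ + i) n≡)
                      (trans (ring₂ D T U (+ k) (+ i)) (cong (D *ᶻ U -ᶻ_) (sym (+[m∸n]≡+m-+n i≤k))))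

-1< : ∀ {n} → + 0 ≤ᶻ n → negᶻ (+ 1) <ᶻ n
-1< p = ZP.<-≤-trans -<+ p

coeff-polyPart-nonneg : ∀ t k → + 0 ≤ᶻ (top t -ᶻ + k) → coeff (polyPart t) k ≡ coeffAt t (top t -ᶻ + k)
coeff-polyPart-nonneg t k p with + 0 ≤ᶻ? (top t -ᶻ + k)
... | yes _ = refl
... | no np = ⊥-elim (np p)

coeff-polyPart-neg : ∀ t k → (top t -ᶻ + k) <ᶻ + 0 → coeff (polyPart t) k ≡ 0ℚ
coeff-polyPart-neg t k p with + 0 ≤ᶻ? (top t -ᶻ + k)
... | yes r = ⊥-elim (ZP.<⇒≱ p r)
... | no _ = refl

coeffAt-polyPart : ∀ t n → + 0 ≤ᶻ n → coeffAt (polyPart t) n ≡ coeffAt t n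
coeffAt-polyPart t n p with ≤⊎> n (top t)
... | inj₂ q = trans (vanishesAbove-top (polyPart t) n q) (sym (vanishesAbove-top t n q))
... | inj₁ q = trans (coeffAt-≤top (top t) _ n q) (trans (coeff-polyPart-nonneg t _ (subst (+ 0 ≤ᶻ_) (sym (T-+∣T-n∣≡n q)) p)) (cong (coeffAt t) (T-+∣T-n∣≡n q)))

coeffAt-polyPart-neg : ∀ t n → n <ᶻ + 0 → coeffAt (polyPart t) n ≡ 0ℚ
coeffAt-polyPart-neg t n p with ≤⊎> n (top t)
... | inj₂ q = vanishesAbove-top (polyPart t) n q
... | inj₁ q = trans (coeffAt-≤top (top t) _ n q) (coeff-polyPart-neg t _ (subst (_<ᶻ + 0) (sym (T-+∣T-n∣≡n q)) p))

coeffAt-fracPart : ∀ t n → n <ᶻ + 0 → coeffAt (fracPart t) n ≡ coeffAt t n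
coeffAt-fracPart t n p = coeffAt-fromFn (negᶻ (+ 1)) (coeffAt t) n (ZP.i<j⇒i≤pred[j] p)

coeffAt-fracPart-nonneg : ∀ t n → + 0 ≤ᶻ n → coeffAt (fracPart t) n ≡ 0ℚ
coeffAt-fracPart-nonneg t n p = vanishesAbove-top (fracPart t) n (-1< p)

polyPart+fracPart : ∀ t → t ≈ polyPart t +S fracPart t
polyPart+fracPart t n with ≤⊎> (+ 0) n
... | inj₁ p = sym (trans (coeffAt-+S (polyPart t) (fracPart t) n) (trans (cong₂ _+ᵠ_ (coeffAt-polyPart t n p) (coeffAt-fracPart-nonneg t n p)) (QP.+-identityʳ (coeffAt t n))))
... | inj₂ p = sym (trans (coeffAt-+S (polyPart t) (fracPart t) n) (trans (cong₂ _+ᵠ_ (coeffAt-polyPart-neg t n p) (coeffAt-fracPart t n p)) (QP.+-identityˡ (coeffAt t n))))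

IsPoly-polyPart : ∀ t → IsPoly (polyPart t)
IsPoly-polyPart t = coeffAt-polyPart-neg t

DegLe-fracPart : ∀ t → DegLe (fracPart t) (negᶻ (+ 1))
DegLe-fracPart t = vanishesAbove-top (fracPart t)

HasDeg-polyPart : ∀ t a → HasDeg t a → + 0 ≤ᶻ a → HasDeg (polyPart t) a
HasDeg-polyPart t a (nz , v) p = (λ z → nz (trans (sym (coeffAt-polyPart t a p)) z)) ,
  (λ n q → trans (coeffAt-polyPart t n (ZP.≤-trans p (ZP.<⇒≤ q))) (v n q))

IsPoly-+ : ∀ {f g} → IsPoly f → IsPoly g → IsPoly (f +S g)
IsPoly-+ {f} {g} pf pg n p = trans (coeffAt-+S f g n) (trans (cong₂ _+ᵠ_ (pf n p) (pg n p)) (QP.+-identityʳ 0ℚ))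

IsPoly-neg : ∀ {f} → IsPoly f → IsPoly (negS f)
IsPoly-neg {f} pf n p = trans (coeffAt-negS f n) (cong -ᵠ_ (pf n p))

IsPoly-* : ∀ {f g} → IsPoly f → IsPoly g → IsPoly (f *S g)
IsPoly-* {f} {g} pf pg n p with window n (top f) (top g)
... | K , w = trans (coeffAt-*S f g n (top f) K (vanishesAbove-top f) (VanishesAbove-mono w (vanishesAbove-top g))) (sumTo-0 K term)
  where
  ring : ∀ n T i → n -ᶻ T +ᶻ i ≡ n -ᶻ (T -ᶻ i)
  ring = solve-∀
  term : ∀ i → i ≤ K → coeffAt f (top f -ᶻ + i) *ᵠ coeffAt g (n -ᶻ top f +ᶻ + i) ≡ 0ℚ
  term i _ with ≤⊎> (+ 0) (top f -ᶻ + i)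
  ... | inj₂ q = ≡0⇒*-zeroˡ (coeffAt g (n -ᶻ top f +ᶻ + i)) (pf _ q)
  ... | inj₁ q = ≡0⇒*-zeroʳ (coeffAt f (top f -ᶻ + i)) (pg _ (subst (_<ᶻ + 0) (sym (ring n (top f) (+ i))) (lt-sub n _ p q)))
    where
    lt-sub : ∀ n x → n <ᶻ + 0 → + 0 ≤ᶻ x → n -ᶻ x <ᶻ + 0
    lt-sub n x p q = subst (n -ᶻ x <ᶻ_) (ZP.+-identityʳ (+ 0)) (ZP.+-mono-<-≤ p (ZP.neg-mono-≤ q))

IsPoly-zero : IsPoly zeroS
IsPoly-zero n _ = coeffAt-zeroS n

IsPoly-one : IsPoly oneS
IsPoly-one n p = coeffAt-oneS n (λ { refl → ZP.<-irrefl refl p })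

IsPoly∧DegLe-1⇒≈0 : ∀ {f} → IsPoly f → DegLe f (negᶻ (+ 1)) → f ≈ zeroS
IsPoly∧DegLe-1⇒≈0 {f} pf v n with ≤⊎> (+ 0) n
... | inj₁ p = trans (v n (-1< p)) (sym (coeffAt-zeroS n))
... | inj₂ p = trans (pf n p) (sym (coeffAt-zeroS n))

module S = CommutativeRing Series-commutativeRing

error-step : ∀ a t r r′ E E′ → E ≈ negS (r *S E′) → t *S r ≈ oneS → t ≈ a +S r′ →
  a *S E +S E′ ≈ negS (r′ *S E)
error-step a t r r′ E E′ E≈ tr≈1 t≈ = begin
    a *S E +S E′                          ≈⟨ S.+-cong (S.refl {a *S E}) (S.sym (*S-idˡ E′)) ⟩
    a *S E +S oneS *S E′                  ≈⟨ S.+-cong (S.refl {a *S E}) (S.*-cong (S.sym tr≈1) (S.refl {E′})) ⟩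
    a *S E +S (t *S r) *S E′              ≈⟨ reassoc a E t r E′ ⟩
    a *S E +S negS (t *S negS (r *S E′))  ≈⟨ S.+-cong (S.refl {a *S E}) (S.-‿cong (S.*-cong (S.refl {t}) (S.sym E≈))) ⟩
    a *S E +S negS (t *S E)               ≈⟨ S.+-cong (S.refl {a *S E}) (S.-‿cong (S.*-cong t≈ (S.refl {E}))) ⟩
    a *S E +S negS ((a +S r′) *S E)       ≈⟨ cancel a E r′ ⟩
    negS (r′ *S E)                        ∎
  where
  open SetR S.setoid
  reassoc : ∀ a E t r E′ → a *S E +S (t *S r) *S E′ ≈ a *S E +S negS (t *S negS (r *S E′))
  reassoc = solve 5 (λ a E t r E′ → a :* E :+ (t :* r) :* E′ := a :* E :+ :- (t :* :- (r :* E′))) (λ _ → refl)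
  cancel : ∀ a E r′ → a *S E +S negS ((a +S r′) *S E) ≈ negS (r′ *S E)
  cancel = solve 3 (λ a E r′ → a :* E :+ :- ((a :+ r′) :* E) := :- (r′ :* E)) (λ _ → refl)

compose-error : ∀ e {A B f} → B *S f ≈ A *S compose f (suc e) → ∀ g h →
  (B *S compose g (suc e)) *S f +S negS (A *S compose h (suc e)) ≈ A *S compose (g *S f +S negS h) (suc e)
compose-error e {A} {B} {f} fe g h = begin
    (B *S g′) *S f +S negS (A *S h′)    ≈⟨ commute B g′ f (negS (A *S h′)) ⟩
    g′ *S (B *S f) +S negS (A *S h′)    ≈⟨ S.+-cong (S.*-cong (S.refl {g′}) fe) (S.refl {negS (A *S h′)}) ⟩
    g′ *S (A *S f′) +S negS (A *S h′)   ≈⟨ factor A g′ f′ h′ ⟩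
    A *S (g′ *S f′ +S negS h′)          ≈⟨ S.*-cong (S.refl {A}) (S.sym compose-hom) ⟩
    A *S compose (g *S f +S negS h) d   ∎
  where
  open SetR S.setoid
  d = suc e
  f′ = compose f d
  g′ = compose g d
  h′ = compose h d
  compose-hom : compose (g *S f +S negS h) d ≈ g′ *S f′ +S negS h′
  compose-hom = S.trans (compose-+S e (g *S f) (negS h)) (S.+-cong (compose-*S e g f) (compose-negS e h))
  commute : ∀ B g f N → (B *S g) *S f +S N ≈ g *S (B *S f) +S N
  commute = solve 4 (λ B g f N → (B :* g) :* f :+ N := g :* (B :* f) :+ N) (λ _ → refl)
  factor : ∀ A g f h → g *S (A *S f) +S negS (A *S h) ≈ A *S (g *S f +S negS h)
  factor = solve 4 (λ A g f h → g :* (A :* f) :+ :- (A :* h) := A :* (g :* f :+ :- h)) (λ _ → refl)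

HasDeg-*-compose : ∀ e {B g b n} → HasDeg B (+ b) → HasDeg g (+ n) → HasDeg (B *S compose g (suc e)) (+ (b + suc e * n))
HasDeg-*-compose e {b = b} {n} hB hg =
  subst (HasDeg _) (sym (trans (ZP.pos-+ b (suc e * n)) (cong (+ b +ᶻ_) (ZP.pos-* (suc e) n))))
        (HasDeg-* hB (HasDeg-compose e hg))

diff-≤-diff : ∀ {a b c e} → a + e ≤ c + b → + a -ᶻ + b ≤ᶻ + c -ᶻ + e
diff-≤-diff {a} {b} {c} {e} a+e≤c+b =
  subst₂ _≤ᶻ_ lhs rhs (ZP.+-monoˡ-≤ (negᶻ (+ b +ᶻ + e)) (+≤+ a+e≤c+b))
  where
  cancel₁ : ∀ a b e → a +ᶻ e +ᶻ negᶻ (b +ᶻ e) ≡ a -ᶻ b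
  cancel₁ = solve-∀
  cancel₂ : ∀ c b e → c +ᶻ b +ᶻ negᶻ (b +ᶻ e) ≡ c -ᶻ e
  cancel₂ = solve-∀
  lhs : + (a + e) +ᶻ negᶻ (+ b +ᶻ + e) ≡ + a -ᶻ + b
  lhs = trans (cong (_+ᶻ negᶻ (+ b +ᶻ + e)) (ZP.pos-+ a e)) (cancel₁ (+ a) (+ b) (+ e))
  rhs : + (c + b) +ᶻ negᶻ (+ b +ᶻ + e) ≡ + c -ᶻ + e
  rhs = trans (cong (_+ᶻ negᶻ (+ b +ᶻ + e)) (ZP.pos-+ c b)) (cancel₂ (+ c) (+ b) (+ e))

diff-≤-diff⁻¹ : ∀ {a b c e} → + a -ᶻ + b ≤ᶻ + c -ᶻ + e → a + e ≤ c + b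
diff-≤-diff⁻¹ {a} {b} {c} {e} ≤ =
  ZP.drop‿+≤+ (subst₂ _≤ᶻ_ lhs rhs (ZP.+-monoˡ-≤ (+ b +ᶻ + e) ≤))
  where
  restore₁ : ∀ a b e → a -ᶻ b +ᶻ (b +ᶻ e) ≡ a +ᶻ e
  restore₁ = solve-∀
  restore₂ : ∀ c b e → c -ᶻ e +ᶻ (b +ᶻ e) ≡ c +ᶻ b
  restore₂ = solve-∀
  lhs : + a -ᶻ + b +ᶻ (+ b +ᶻ + e) ≡ + (a + e)
  lhs = trans (restore₁ (+ a) (+ b) (+ e)) (sym (ZP.pos-+ a e))
  rhs : + c -ᶻ + e +ᶻ (+ b +ᶻ + e) ≡ + (c + b)
  rhs = trans (restore₂ (+ c) (+ b) (+ e)) (sym (ZP.pos-+ c b))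

-- Convergents

module Convergents (f : Series) (cf : CFExpansion f) where
  open CFExpansion cf

  remainder : ℕ → Series
  remainder k = fracPart (tail k)

  -- Kept opaque: unfolding these degree witnesses slows down type checking of the later proofs considerably.
  opaque
    tail-degree : ∀ k → Σ ℕ λ n → HasDeg (tail (suc k)) (+ suc n) × HasDeg (remainder k) (negᶻ (+ suc n))
    tail-degree k
      with invertible⇒HasDeg (tail (suc k)) (remainder k) (tailStep k)
         | invertible⇒HasDeg (remainder k) (tail (suc k)) (S.trans (S.*-comm (remainder k) (tail (suc k))) (tailStep k))
    ... | α , hα | β , hβ =
      from-degrees β hβ (HasDeg-uniq (HasDeg-≈ (tailStep k) (HasDeg-* hα hβ)) HasDeg-one)
                        (HasDeg⇒≤ hβ (DegLe-fracPart (tail k)))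
      where
      from-degrees : ∀ β → HasDeg (remainder k) β → α +ᶻ β ≡ + 0 → β ≤ᶻ negᶻ (+ 1) →
                     Σ ℕ λ n → HasDeg (tail (suc k)) (+ suc n) × HasDeg (remainder k) (negᶻ (+ suc n))
      from-degrees (+ _)    _  _     β≤-1 = ⊥-elim (ZP.<⇒≱ -<+ β≤-1)
      from-degrees -[1+ n ] hβ α+β≡0 _    = n , subst (HasDeg (tail (suc k))) α≡ hα , hβ
        where
        cancel : ∀ α β → α ≡ (α +ᶻ β) -ᶻ β
        cancel = solve-∀
        α≡ : α ≡ + suc n
        α≡ = trans (cancel α -[1+ n ]) (cong (_-ᶻ -[1+ n ]) α+β≡0)

  deg-a : ℕ → ℕ
  deg-a k = suc (proj₁ (tail-degree k))

  deg-q : ℕ → ℕ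
  deg-q zero    = 0
  deg-q (suc k) = deg-q k + deg-a k

  HasDeg-a : ∀ k → HasDeg (a (suc k)) (+ deg-a k)
  HasDeg-a k = HasDeg-polyPart (tail (suc k)) (+ deg-a k) (proj₁ (proj₂ (tail-degree k))) (+≤+ z≤n)

  HasDeg-QQ : ∀ k → HasDeg (q k) (+ deg-q k) × DegLe (proj₁ (QQ k)) (+ deg-q k -ᶻ + 1)
  HasDeg-QQ zero    = HasDeg-one , (λ n _ → coeffAt-zeroS n)
  HasDeg-QQ (suc k) with HasDeg-QQ k
  ... | hq , hq₋ =
    subst (HasDeg (q (suc k))) deg≡ (HasDeg-+ (HasDeg-* (HasDeg-a k) hq) hq₋ lower) ,
    VanishesAbove-mono below (proj₂ hq)
    where
    deg≡ : + deg-a k +ᶻ + deg-q k ≡ + deg-q (suc k)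
    deg≡ = trans (ZP.+-comm (+ deg-a k) (+ deg-q k)) (sym (ZP.pos-+ (deg-q k) (deg-a k)))
    lower : + deg-q k -ᶻ + 1 <ᶻ + deg-a k +ᶻ + deg-q k
    lower = ZP.<-≤-trans (ZP.m⊖1+n<m (deg-q k) 1) (ZP.i≤j+i (+ deg-q k) (+ deg-a k))
    below : + deg-q k ≤ᶻ + deg-q (suc k) -ᶻ + 1
    below = subst (_≤ᶻ + deg-q (suc k) -ᶻ + 1) (ZP.+-identityʳ (+ deg-q k))
              (diff-≤-diff {deg-q k} {0} {deg-q (suc k)} {1} (NP.≤-trans (NP.+-monoʳ-≤ (deg-q k) (s≤s z≤n)) (NP.m≤m+n (deg-q (suc k)) 0)))

  IsPoly-QQ : ∀ k → IsPoly (q k) × IsPoly (proj₁ (QQ k))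
  IsPoly-QQ zero    = IsPoly-one , IsPoly-zero
  IsPoly-QQ (suc k) with IsPoly-QQ k
  ... | pq , pq₋ = IsPoly-+ (IsPoly-* (IsPoly-polyPart (tail (suc k))) pq) pq₋ , pq

  IsPoly-PP : ∀ k → IsPoly (p k) × IsPoly (proj₁ (PP k))
  IsPoly-PP zero    = IsPoly-polyPart (tail 0) , IsPoly-one
  IsPoly-PP (suc k) with IsPoly-PP k
  ... | pp , pp₋ = IsPoly-+ (IsPoly-* (IsPoly-polyPart (tail (suc k))) pp) pp₋ , pp

  error error₋ : ℕ → Series
  error  k = q k *S f +S negS (p k)
  error₋ k = proj₁ (QQ k) *S f +S negS (proj₁ (PP k))

  error-recurrence : ∀ k → error k ≈ negS (remainder k *S error₋ k)
  error-recurrence zero = begin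
      oneS *S f +S negS (a 0)              ≈⟨ S.+-cong (S.trans (*S-idˡ f) f≈) (S.refl {negS (a 0)}) ⟩
      (a 0 +S remainder 0) +S negS (a 0)   ≈⟨ cancel (a 0) (remainder 0) ⟩
      remainder 0                          ≈⟨ S.sym (*S-idʳ (remainder 0)) ⟩
      remainder 0 *S oneS                  ≈⟨ S.sym (double-neg (remainder 0) oneS) ⟩
      negS (remainder 0 *S negS oneS)      ≈⟨ S.-‿cong (S.*-cong (S.refl {remainder 0}) (S.sym error₋0)) ⟩
      negS (remainder 0 *S error₋ 0)       ∎
    where
    open SetR S.setoid
    f≈ : f ≈ a 0 +S remainder 0
    f≈ = S.trans (S.sym tail0) (polyPart+fracPart (tail 0))
    cancel : ∀ a r → (a +S r) +S negS a ≈ r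
    cancel = solve 2 (λ a r → (a :+ r) :+ :- a := r) (λ _ → refl)
    double-neg : ∀ r o → negS (r *S negS o) ≈ r *S o
    double-neg = solve 2 (λ r o → :- (r :* :- o) := r :* o) (λ _ → refl)
    error₋0 : error₋ 0 ≈ negS oneS
    error₋0 = S.trans (S.+-cong (S.zeroˡ f) (S.refl {negS oneS})) (+S-idˡ (negS oneS))
  error-recurrence (suc k) =
    S.trans (regroup (a (suc k)) (q k) (proj₁ (QQ k)) (p k) (proj₁ (PP k)) f)
            (error-step (a (suc k)) (tail (suc k)) (remainder k) (remainder (suc k)) (error k) (error₋ k)
                        (error-recurrence k) (tailStep k) (polyPart+fracPart (tail (suc k))))
    where
    regroup : ∀ a q q₋ p p₋ f → (a *S q +S q₋) *S f +S negS (a *S p +S p₋) ≈ a *S (q *S f +S negS p) +S (q₋ *S f +S negS p₋)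
    regroup = solve 6 (λ a q q₋ p p₋ f → (a :* q :+ q₋) :* f :+ :- (a :* p :+ p₋) := a :* (q :* f :+ :- p) :+ (q₋ :* f :+ :- p₋)) (λ _ → refl)

  HasDeg-error₋ : ∀ k → HasDeg (error₋ k) (negᶻ (+ deg-q k))
  HasDeg-error  : ∀ k → HasDeg (error k) (negᶻ (+ deg-q (suc k)))
  HasDeg-error₋ zero    = HasDeg-≈ (S.trans (S.sym (+S-idˡ (negS oneS))) (S.+-cong (S.sym (S.zeroˡ f)) (S.refl {negS oneS}))) (HasDeg-neg HasDeg-one)
  HasDeg-error₋ (suc k) = HasDeg-error k
  HasDeg-error k =
    HasDeg-≈ (S.sym (error-recurrence k))
      (subst (HasDeg (negS (remainder k *S error₋ k))) deg≡
        (HasDeg-neg (HasDeg-* (proj₂ (proj₂ (tail-degree k))) (HasDeg-error₋ k))))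
    where
    neg-+ : ∀ D E → negᶻ E +ᶻ negᶻ D ≡ negᶻ (D +ᶻ E)
    neg-+ = solve-∀
    deg≡ : negᶻ (+ deg-a k) +ᶻ negᶻ (+ deg-q k) ≡ negᶻ (+ deg-q (suc k))
    deg≡ = trans (neg-+ (+ deg-q k) (+ deg-a k)) (cong negᶻ (sym (ZP.pos-+ (deg-q k) (deg-a k))))

  deg-q-< : ∀ k → deg-q k < deg-q (suc k)
  deg-q-< k = NP.m<m+n (deg-q k) (s≤s z≤n)

  deg-q-mono : ∀ {k k′} → k ≤ k′ → deg-q k ≤ deg-q k′
  deg-q-mono {k′ = zero}   z≤n = NP.≤-refl
  deg-q-mono {k′ = suc k′} k≤ with NP.m≤n⇒m<n∨m≡n k≤
  ... | inj₁ (s≤s k≤k′) = NP.≤-trans (deg-q-mono k≤k′) (NP.<⇒≤ (deg-q-< k′))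
  ... | inj₂ refl       = NP.≤-refl

  InΦ⇒≡deg-q : ∀ {m} → InΦ m → Σ ℕ λ i → m ≡ deg-q i
  InΦ⇒≡deg-q (i , h) = i , ZP.+-injective (HasDeg-uniq h (proj₁ (HasDeg-QQ i)))

  Gap-deg-q : ∀ j → Gap (deg-q j) (deg-q (suc j))
  Gap-deg-q j = deg-q-< j , (j , proj₁ (HasDeg-QQ j)) , (suc j , proj₁ (HasDeg-QQ (suc j))) ,
                λ w j< <sj inΦ → strictly-between w j< <sj (InΦ⇒≡deg-q inΦ)
    where
    strictly-between : ∀ w → deg-q j < w → w < deg-q (suc j) → ¬ (Σ ℕ λ i → w ≡ deg-q i)
    strictly-between _ j< <sj (i , refl) with NP.≤-total i j
    ... | inj₁ i≤j = NP.<⇒≱ j< (deg-q-mono i≤j)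
    ... | inj₂ j≤i with NP.m≤n⇒m<n∨m≡n j≤i
    ...   | inj₁ j<i = NP.<⇒≱ <sj (deg-q-mono j<i)
    ...   | inj₂ refl = NP.<-irrefl refl j<

  bracket : ∀ s → Σ ℕ λ j → deg-q j ≤ s × s < deg-q (suc j)
  bracket zero = 0 , z≤n , deg-q-< 0
  bracket (suc s) with bracket s
  ... | j , j≤s , s<sj with suc s NP.<? deg-q (suc j)
  ...   | yes s<  = j , NP.m≤n⇒m≤1+n j≤s , s<
  ...   | no  s≮  = suc j , NP.≮⇒≥ s≮ , NP.≤-<-trans s<sj (deg-q-< (suc j))

  Gap⇒≤deg-q : ∀ {u v k} → Gap u v → HasDeg (q k) (+ u) → v ≤ deg-q (suc k)
  Gap⇒≤deg-q {u} {v} {k} (_ , _ , _ , empty) hk with deg-q (suc k) NP.<? v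
  ... | no  sk≮v = NP.≮⇒≥ sk≮v
  ... | yes sk<v = ⊥-elim (empty (deg-q (suc k)) (subst (_< deg-q (suc k)) (sym u≡) (deg-q-< k)) sk<v (suc k , proj₁ (HasDeg-QQ (suc k))))
    where
    u≡ : u ≡ deg-q k
    u≡ = ZP.+-injective (HasDeg-uniq hk (proj₁ (HasDeg-QQ k)))

  convergent-unique : ∀ {Q P s m} j → IsPoly Q → IsPoly P → DegLe Q (+ s) → s < deg-q (suc j) →
                      DegLe (Q *S f +S negS P) m → + deg-q j +ᶻ m ≤ᶻ negᶻ (+ 1) → Q *S p j ≈ P *S q j
  convergent-unique {Q} {P} {s} {m} j pQ pP degQ s< degX small =
    S.trans (split (Q *S p j) (P *S q j)) (S.trans (S.+-cong difference≈0 (S.refl {P *S q j})) (+S-idˡ (P *S q j)))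
    where
    difference≈ : Q *S p j +S negS (P *S q j) ≈ q j *S (Q *S f +S negS P) +S negS (Q *S error j)
    difference≈ = solve 5 (λ Q P q p f → Q :* p :+ :- (P :* q) := q :* (Q :* f :+ :- P) :+ :- (Q :* (q :* f :+ :- p)))
                          (λ _ → refl) Q P (q j) (p j) f
    Qerror-small : DegLe (Q *S error j) (negᶻ (+ 1))
    Qerror-small = VanishesAbove-mono (diff-≤-diff {s} {deg-q (suc j)} {0} {1} (subst (_≤ deg-q (suc j)) (NP.+-comm 1 s) s<))
                                      (DegLe-* degQ (proj₂ (HasDeg-error j)))
    difference≈0 : Q *S p j +S negS (P *S q j) ≈ zeroS
    difference≈0 = IsPoly∧DegLe-1⇒≈0
      (IsPoly-+ (IsPoly-* pQ (proj₁ (IsPoly-PP j))) (IsPoly-neg (IsPoly-* pP (proj₁ (IsPoly-QQ j)))))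
      (DegLe-≈ (S.sym difference≈)
        (DegLe-+ (VanishesAbove-mono small (DegLe-* (proj₂ (proj₁ (HasDeg-QQ j))) degX)) (DegLe-neg Qerror-small)))
    split : ∀ a b → a ≈ (a +S negS b) +S b
    split = solve 2 (λ a b → a := (a :+ :- b) :+ b) (λ _ → refl)

  convergent-error-bound : ∀ {Q P s m} j → HasDeg Q (+ s) → DegLe (Q *S f +S negS P) m → Q *S p j ≈ P *S q j →
                           + s -ᶻ + deg-q (suc j) ≤ᶻ + deg-q j +ᶻ m
  convergent-error-bound {Q} {P} j hQ degX Qp≈Pq =
    HasDeg⇒≤ (HasDeg-≈ Qerror≈ (HasDeg-* hQ (HasDeg-error j))) (DegLe-* (proj₂ (proj₁ (HasDeg-QQ j))) degX)
    where
    expand : ∀ Q q f p → Q *S (q *S f +S negS p) ≈ q *S (Q *S f) +S negS (Q *S p)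
    expand = solve 4 (λ Q q f p → Q :* (q :* f :+ :- p) := q :* (Q :* f) :+ :- (Q :* p)) (λ _ → refl)
    factor : ∀ Q q f P → q *S (Q *S f) +S negS (P *S q) ≈ q *S (Q *S f +S negS P)
    factor = solve 4 (λ Q q f P → q :* (Q :* f) :+ :- (P :* q) := q :* (Q :* f :+ :- P)) (λ _ → refl)
    Qerror≈ : Q *S error j ≈ q j *S (Q *S f +S negS P)
    Qerror≈ = S.trans (expand Q (q j) f (p j))
                (S.trans (S.+-cong (S.refl {q j *S (Q *S f)}) (S.-‿cong Qp≈Pq)) (factor Q (q j) f P))

  DegLe-transformed-error : ∀ e {A B ra v k} → B *S f ≈ A *S compose f (suc e) → DegLe A (+ ra) → v ≤ deg-q (suc k) →
    DegLe ((B *S compose (q k) (suc e)) *S f +S negS (A *S compose (p k) (suc e))) (+ ra -ᶻ + (suc e * v))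
  DegLe-transformed-error e {A} {B} {ra} {v} {k} fe degA v≤ =
    DegLe-≈ (S.sym (compose-error e {A} {B} {f} fe (q k) (p k)))
            (VanishesAbove-mono bound (DegLe-* degA (DegLe-compose e (proj₂ (HasDeg-error k)))))
    where
    n = deg-q (suc k)
    scale : negᶻ (+ (suc e * n)) ≡ + suc e *ᶻ negᶻ (+ n)
    scale = trans (cong negᶻ (ZP.pos-* (suc e) n)) (ZP.neg-distribʳ-* (+ suc e) (+ n))
    bound : + ra +ᶻ + suc e *ᶻ negᶻ (+ n) ≤ᶻ + ra -ᶻ + (suc e * v)
    bound = subst (_≤ᶻ + ra -ᶻ + (suc e * v)) (cong (+ ra +ᶻ_) scale)
                  (diff-≤-diff {ra} {suc e * n} {ra} {suc e * v} (NP.+-monoʳ-≤ ra (NP.*-monoʳ-≤ (suc e) v≤)))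

-- Arithmetic of big gaps

+-assoc-diff : ∀ x r t → + x +ᶻ (+ r -ᶻ + t) ≡ + (x + r) -ᶻ + t
+-assoc-diff x r t = trans (sym (ZP.+-assoc (+ x) (+ r) (negᶻ (+ t)))) (cong (_-ᶻ + t) (sym (ZP.pos-+ x r)))

big-gap-slack : ∀ e {ra rb u v} → u ≤ v → ra + rb < (v ∸ u) * e → rb + suc e * u + ra + (v ∸ u) < suc e * v
big-gap-slack e {ra} {rb} {u} {v} u≤v big = begin-strict
  rb + suc e * u + ra + δ      ≡⟨ regroup rb (suc e * u) ra δ ⟩
  suc e * u + δ + (ra + rb)    <⟨ NP.+-monoʳ-< (suc e * u + δ) big ⟩
  suc e * u + δ + δ * e        ≡⟨ distrib e u δ ⟩
  suc e * (u + δ)              ≡⟨ cong (suc e *_) (NP.m+[n∸m]≡n u≤v) ⟩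
  suc e * v                    ∎
  where
  open NP.≤-Reasoning
  δ = v ∸ u
  regroup : ∀ rb du ra δ → rb + du + ra + δ ≡ du + δ + (ra + rb)
  regroup = ℕsolve-∀
  distrib : ∀ e u δ → suc e * u + δ + δ * e ≡ suc e * (u + δ)
  distrib = ℕsolve-∀

error-below-one : ∀ {x s r δ t} → x ≤ s → s + r + δ < t → x + r + 1 ≤ t
error-below-one {x} {s} {r} {δ} {t} x≤s slack = begin
  x + r + 1        ≡⟨ NP.+-comm (x + r) 1 ⟩
  suc (x + r)      ≤⟨ s≤s (NP.+-monoˡ-≤ r x≤s) ⟩
  suc (s + r)      ≤⟨ s≤s (NP.m≤m+n (s + r) δ) ⟩
  suc (s + r + δ)  ≤⟨ slack ⟩
  t                ∎
  where open NP.≤-Reasoning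

gap-growth : ∀ {x s r δ t w} → x ≤ s → s + r + δ < t → s + t ≤ x + r + w → δ < w ∸ x
gap-growth {x} {s} {r} {δ} {t} {w} x≤s slack ≤w =
  subst (_< w ∸ x) (NP.m+n∸m≡n x δ) (NP.∸-monoˡ-< x+δ<w (NP.m≤m+n x δ))
  where
  x+δ<w : x + δ < w
  x+δ<w = NP.+-cancelʳ-< (x + r) (x + δ) w (begin-strict
    x + δ + (x + r)      ≡⟨ regroup x δ r ⟩
    x + (x + r + δ)      ≤⟨ NP.+-mono-≤ x≤s (NP.+-monoˡ-≤ δ (NP.+-monoˡ-≤ r x≤s)) ⟩
    s + (s + r + δ)      <⟨ NP.+-monoʳ-< s slack ⟩
    s + t                ≤⟨ ≤w ⟩
    x + r + w            ≡⟨ NP.+-comm (x + r) w ⟩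
    w + (x + r)          ∎)
    where
    open NP.≤-Reasoning
    regroup : ∀ x δ r → x + δ + (x + r) ≡ x + (x + r + δ)
    regroup = ℕsolve-∀

lemma5 : (d : ℕ) → 2 ≤ d →
         (A B : Series) → IsPoly A → IsPoly B → ¬ (B ≈ zeroS) →
         (ra rb : ℕ) → HasDeg A (+ ra) → HasDeg B (+ rb) →
         (f : Series) → ¬ IsRational f →
         (B *S f ≈ A *S compose f d) →
         (cf : CFExpansion f) →
         (u v : ℕ) → CFExpansion.Gap cf u v →
         ra + rb < (v ∸ u) * (d ∸ 1) →
         (k : ℕ) → HasDeg (CFExpansion.q cf k) (+ u) →
         Σ ℕ λ j →
           ((A *S compose (CFExpansion.p cf k) d) *S CFExpansion.q cf j
              ≈ (B *S compose (CFExpansion.q cf k) d) *S CFExpansion.p cf j)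
           × Σ ℕ λ w → Σ ℕ λ v' →
               HasDeg (CFExpansion.q cf j) (+ w) × CFExpansion.Gap cf w v'
               × v ∸ u < v' ∸ w
-- B ≢ 0 follows from HasDeg B and irrationality of f from the infinite expansion cf.
lemma5 (suc (suc e)) (s≤s (s≤s z≤n)) A B pA pB _ ra rb hA hB f _ fe cf u v gap@(u<v , _) big k hk =
  j , S.sym Qpⱼ≈Pqⱼ , deg-q j , deg-q (suc j) , proj₁ (HasDeg-QQ j) , Gap-deg-q j , growth
  where
  open CFExpansion cf using (p; q)
  open Convergents f cf
  d = suc (suc e)
  s = rb + d * u
  hQ : HasDeg (B *S compose (q k) d) (+ s)
  hQ = HasDeg-*-compose (suc e) hB hk
  X-bound : DegLe ((B *S compose (q k) d) *S f +S negS (A *S compose (p k) d)) (+ ra -ᶻ + (d * v))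
  X-bound = DegLe-transformed-error (suc e) {A} {B} {k = k} fe (proj₂ hA) (Gap⇒≤deg-q gap hk)
  slack : s + ra + (v ∸ u) < d * v
  slack = big-gap-slack (suc e) {ra} {rb} (NP.<⇒≤ u<v) big
  j = proj₁ (bracket s)
  Dⱼ≤s : deg-q j ≤ s
  Dⱼ≤s = proj₁ (proj₂ (bracket s))
  Qpⱼ≈Pqⱼ : (B *S compose (q k) d) *S p j ≈ (A *S compose (p k) d) *S q j
  Qpⱼ≈Pqⱼ = convergent-unique j (IsPoly-* pB (IsPoly-compose (suc e) (proj₁ (IsPoly-QQ k))))
                                 (IsPoly-* pA (IsPoly-compose (suc e) (proj₁ (IsPoly-PP k))))
                                 (proj₂ hQ) (proj₂ (proj₂ (bracket s))) X-bound
                                 (subst (_≤ᶻ negᶻ (+ 1)) (sym (+-assoc-diff (deg-q j) ra (d * v)))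
                                        (diff-≤-diff {deg-q j + ra} {d * v} {0} {1} (error-below-one Dⱼ≤s slack)))
  growth : v ∸ u < deg-q (suc j) ∸ deg-q j
  growth = gap-growth Dⱼ≤s slack
             (diff-≤-diff⁻¹ {s} {deg-q (suc j)} {deg-q j + ra} {d * v} (subst (+ s -ᶻ + deg-q (suc j) ≤ᶻ_) (+-assoc-diff (deg-q j) ra (d * v))
                                   (convergent-error-bound j hQ X-bound Qpⱼ≈Pqⱼ)))
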